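{- Fix integers $n_1\ge1$, $n_2\ge1$, $n=n_1+n_2$. For integers $1\le m_1\le n_1$, $0\le m_2\le n_2-1$, let $G(m_1,m_2)$ be the simple game on $N=N_1\cup N_2$ ($|N_1|=n_1$, $|N_2|=n_2$) where $S$ is winning iff $|S\cap N_1|\ge m_1$ and $|S|\ge m_1+m_2$, and let $SS_1(m_1,m_2)$, $SS_2(m_1,m_2)$ be the Shapley–Shubik index of a player of $N_1$, respectively $N_2$, in $G(m_1,m_2)$. (1) If $(m_1,m_2)\neq(m_1',m_2')$ are two such pairs with $m_1\ge m_1'$ and $m_2\le m_2'$, then $SS_2(m_1,m_2)\le SS_2(m_1',m_2')$ and $SS_1(m_1,m_2)\ge SS_1(m_1',m_2')$, with equality if and only if $m_2=m_2'=0$. (2) Suppose $n_2\ge2$ and $1\le m_2\le n_2-1$, $1\le m_1\le n_1$. Then for every integer $1\le c\le n_1$, $\frac1n<SS_1(1,n_2-1)\le SS_1(m_1,m_2)\le SS_1(n_1,1)<SS_1(c,0)=\frac1{n_1}$ and $\frac1n>SS_2(1,n_2-1)\ge SS_2(m_1,m_2)\ge SS_2(n_1,1)>SS_2(c,0)=0.$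
   Context: A coalition $S$ is a swing for $i\in S$ if $S$ is winning and $S\setminus\{i\}$ is losing. The Shapley–Shubik index of player $i$ in a simple game on $n$ players is $\sum_{S}\frac{(|S|-1)!(n-|S|)!}{n!}$ over all swings $S$ for $i$. $G(m_1,m_2)$ is the complete game with two classes and unique shift-minimal winning vector $(m_1,m_2)$; all players within $N_h$ have equal index. -}

module Defs where

open import Data.Bool using (Bool; true; false; _∧_; not; if_then_else_)
open import Data.Nat using (ℕ; zero; suc; _∸_; _≤ᵇ_; _!)
open import Data.Integer using (+_)
open import Data.Fin using (Fin; zero; suc; toℕ; _↑ˡ_; _↑ʳ_)
open import Data.Vec using (Vec; []; _∷_; lookup; _[_]≔_)
open import Data.List using (List; []; _∷_; map; _++_; foldr)
import Data.Product
import Data.Nat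
open import Data.Rational using (ℚ; _/_; 0ℚ)
open Data.Rational using () renaming (_+_ to _+ℚ_)

-- a / b as a rational, with the convention a / 0 = 0 (never used with b = 0)
frac : ℕ → ℕ → ℚ
frac a zero    = 0ℚ
frac a (suc b) = (+ a) / suc b

Coalition : ℕ → Set
Coalition n = Vec Bool n

allCoalitions : (n : ℕ) → List (Coalition n)
allCoalitions zero    = [] ∷ []
allCoalitions (suc n) = map (true ∷_) (allCoalitions n) ++ map (false ∷_) (allCoalitions n)

card : ∀ {n} → Coalition n → ℕ
card []           = 0
card (true ∷ S)   = suc (card S)
card (false ∷ S)  = card S

cardFirst : ∀ {n} → ℕ → Coalition n → ℕ
cardFirst k       []          = 0
cardFirst zero    (_ ∷ S)     = 0
cardFirst (suc k) (true ∷ S)  = suc (cardFirst k S)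
cardFirst (suc k) (false ∷ S) = cardFirst k S

SimpleGame : ℕ → Set
SimpleGame n = Coalition n → Bool

isSwing : ∀ {n} → SimpleGame n → Fin n → Coalition n → Bool
isSwing v i S = lookup S i ∧ v S ∧ not (v (S [ i ]≔ false))

sumℚ : List ℚ → ℚ
sumℚ = foldr _+ℚ_ 0ℚ

shapleyShubik : ∀ {n} → SimpleGame n → Fin n → ℚ
shapleyShubik {n} v i =
  sumℚ (map (λ S → if isSwing v i S
                     then frac ((card S ∸ 1) ! Data.Nat.* (n ∸ card S) !) (n !)
                     else 0ℚ)
            (allCoalitions n))

-- players: Fin (n₁ + n₂); N₁ = the first n₁ players (↑ˡ), N₂ = the rest (raise)
-- G(m₁,m₂): S winning iff |S ∩ N₁| ≥ m₁ and |S| ≥ m₁ + m₂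
G : (n₁ n₂ m₁ m₂ : ℕ) → SimpleGame (n₁ Data.Nat.+ n₂)
G n₁ n₂ m₁ m₂ S = (m₁ ≤ᵇ cardFirst n₁ S) ∧ (m₁ Data.Nat.+ m₂ ≤ᵇ card S)

SS₁ : (n₁ n₂ m₁ m₂ : ℕ) → Fin n₁ → ℚ
SS₁ n₁ n₂ m₁ m₂ i = shapleyShubik (G n₁ n₂ m₁ m₂) (i ↑ˡ n₂)

SS₂ : (n₁ n₂ m₁ m₂ : ℕ) → Fin n₂ → ℚ
SS₂ n₁ n₂ m₁ m₂ j = shapleyShubik (G n₁ n₂ m₁ m₂) (n₁ ↑ʳ j)

Admissible : (n₁ n₂ m₁ m₂ : ℕ) → Set
Admissible n₁ n₂ m₁ m₂ = (1 Data.Nat.≤ m₁) Data.Product.× (m₁ Data.Nat.≤ n₁) Data.Product.× (m₂ Data.Nat.< n₂)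

module Submission where

-- A player of N₂ is a swing of G(m₁, m₂), m₂ ≥ 1, exactly in the coalitions of size q = m₁ + m₂ that
-- contain it and at least m₁ players of N₁; so n! SS₂ = (q − 1)! (n − q)! times the number of (q − 1)-subsets
-- of the other players meeting N₁ in at least m₁ points, and SS₂ = 0 when m₂ = 0. Pascal-type identities for
-- these counts show that this quantity strictly decreases in m₁ and strictly increases in m₂ (once m₂ ≥ 1).
-- Efficiency, n₁ SS₁ + n₂ SS₂ = 1, turns each statement about SS₂ into the reverse one about SS₁. For
-- G(1, n₂ − 1), Vandermonde's identity gives n! SS₂ < (n − 1)!, that is SS₂ < 1/n, and hence SS₁ > 1/n.

open import Defs
open import Data.Nat using (ℕ; _≤_; _∸_; _+_)
open import Data.Fin using (Fin)
open import Data.Product using (_×_)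
open import Function.Bundles using (_⇔_)
open import Relation.Binary.PropositionalEquality using (_≡_)
open import Relation.Nullary using (¬_)
open import Data.Rational using (0ℚ) renaming (_≤_ to _≤ℚ_; _<_ to _<ℚ_)

import Algebra.Properties.CommutativeSemigroup as CommSemigroupProperties
open import Data.Bool using (Bool; true; false; T; _∧_; not; if_then_else_)
open import Data.Bool.Properties using (T-∧)
open import Data.Fin using (zero; suc; _↑ˡ_; _↑ʳ_)
open import Data.Integer as ℤ using (ℤ)
open import Data.Integer.Properties using (pos-*; pos-+)
import Data.Integer.Tactic.RingSolver as ℤ-Solver
open import Data.List using ([]; _∷_; map) renaming (_++_ to _++ₗ_)
open import Data.List.Properties using (map-++; map-∘; map-cong)
open import Data.Nat using (zero; suc; _*_; _<_; _>_; _≤ᵇ_; _≡ᵇ_; _!; z≤n; s≤s; s≤s⁻¹; NonZero; >-nonZero)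
open import Data.Nat.Combinatorics
  using (_C_; nCk+nC[k+1]≡[n+1]C[k+1]; nCn≡1; nCk≡n!/k![n-k]!; k![n∸k]!∣n!; k>n⇒nCk≡0; [n-k]*d[k+1]≡[k+1]*d[k])
open import Data.Nat.DivMod using (m/n*n≡m)
open import Data.Nat.ListAction using (sum)
open import Data.Nat.ListAction.Properties using (sum-++)
open import Data.Nat.Properties
open import Algebra.Properties.CommutativeMonoid.Sum +-0-commutativeMonoid using (sum-syntax; sum-cong-≗; ∑-distrib-+)
open import Data.Nat.Tactic.RingSolver using (solve-∀)
open import Data.Product using (_,_)
open import Data.Rational using (ℚ; toℚᵘ) renaming (_+_ to _+ℚ_)
import Data.Rational.Properties as ℚ
open import Data.Rational.Unnormalised using (mkℚᵘ; *≡*; *≤*; *<*) renaming (_≃_ to _≃ᵘ_)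
import Data.Rational.Unnormalised.Properties as ℚᵘ
open import Data.Sum using (inj₁; inj₂)
open import Data.Vec using (Vec; []; _∷_; lookup; _[_]≔_; _++_; insertAt; replicate)
open import Data.Vec.Properties using (insertAt-lookup; lookup-++ˡ; lookup-++ʳ; []≔-++-↑ˡ; []≔-++-↑ʳ)
open import Function.Bundles using (module Equivalence; mk⇔)
open import Relation.Binary.Definitions using (Transitive; tri<; tri≈; tri>)
open import Relation.Binary.PropositionalEquality
  using (_≢_; refl; sym; trans; cong; cong₂; subst; subst₂; module ≡-Reasoning)
open import Relation.Nullary using (yes; no; contradiction)
open import Relation.Nullary.Decidable using (dec-true; dec-false; _×-dec_)

frac-toℚᵘ : ∀ a d → toℚᵘ (frac a (suc d)) ≃ᵘ mkℚᵘ (ℤ.+ a) d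
frac-toℚᵘ a d = ℚ.toℚᵘ-fromℚᵘ (mkℚᵘ (ℤ.+ a) d)

frac-cross-≡ : ∀ a b d e .{{_ : NonZero d}} .{{_ : NonZero e}} → a * e ≡ b * d → frac a d ≡ frac b e
frac-cross-≡ a b (suc d) (suc e) eq =
  ℚ.fromℚᵘ-cong (*≡* {mkℚᵘ (ℤ.+ a) d} {mkℚᵘ (ℤ.+ b) e}
    (trans (sym (pos-* a (suc e))) (trans (cong ℤ.+_ eq) (pos-* b (suc d)))))

frac-cross-≤ : ∀ a b d e .{{_ : NonZero d}} .{{_ : NonZero e}} → a * e ≤ b * d → frac a d ≤ℚ frac b e
frac-cross-≤ a b (suc d) (suc e) le = ℚ.toℚᵘ-cancel-≤
  (ℚᵘ.≤-respˡ-≃ (ℚᵘ.≃-sym (frac-toℚᵘ a d)) (ℚᵘ.≤-respʳ-≃ (ℚᵘ.≃-sym (frac-toℚᵘ b e))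
    (*≤* (subst₂ ℤ._≤_ (pos-* a (suc e)) (pos-* b (suc d)) (ℤ.+≤+ le)))))

frac-cross-< : ∀ a b d e .{{_ : NonZero d}} .{{_ : NonZero e}} → a * e < b * d → frac a d <ℚ frac b e
frac-cross-< a b (suc d) (suc e) lt = ℚ.toℚᵘ-cancel-<
  (ℚᵘ.<-respˡ-≃ (ℚᵘ.≃-sym (frac-toℚᵘ a d)) (ℚᵘ.<-respʳ-≃ (ℚᵘ.≃-sym (frac-toℚᵘ b e))
    (*<* (subst₂ ℤ._<_ (pos-* a (suc e)) (pos-* b (suc d)) (ℤ.+<+ lt)))))

frac-zero : ∀ d → frac 0 d ≡ 0ℚ
frac-zero zero    = refl
frac-zero (suc d) = frac-cross-≡ 0 0 (suc d) 1 refl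

frac-+ : ∀ a b d → frac a d +ℚ frac b d ≡ frac (a + b) d
frac-+ a b zero    = ℚ.+-identityˡ 0ℚ
frac-+ a b (suc d) = ℚ.toℚᵘ-injective (ℚᵘ.≃-trans (ℚ.toℚᵘ-homo-+ (frac a (suc d)) (frac b (suc d)))
  (ℚᵘ.≃-trans (ℚᵘ.+-cong (frac-toℚᵘ a d) (frac-toℚᵘ b d))
  (ℚᵘ.≃-trans (*≡* (common-denominator a b (suc d))) (ℚᵘ.≃-sym (frac-toℚᵘ (a + b) d)))))
  where
  common-denominator : ∀ a b s → (ℤ.+ a ℤ.* ℤ.+ s ℤ.+ ℤ.+ b ℤ.* ℤ.+ s) ℤ.* ℤ.+ s ≡ ℤ.+ (a + b) ℤ.* (ℤ.+ s ℤ.* ℤ.+ s)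
  common-denominator a b s rewrite pos-+ a b = solve (ℤ.+ a) (ℤ.+ b) (ℤ.+ s)
    where
    solve : ∀ (x y z : ℤ) → (x ℤ.* z ℤ.+ y ℤ.* z) ℤ.* z ≡ (x ℤ.+ y) ℤ.* (z ℤ.* z)
    solve = ℤ-Solver.solve-∀

frac-monoˡ-≤ : ∀ {a b} d → a ≤ b → frac a d ≤ℚ frac b d
frac-monoˡ-≤         zero    _  = ℚ.≤-refl
frac-monoˡ-≤ {a} {b} (suc d) le = frac-cross-≤ a b (suc d) (suc d) (*-monoˡ-≤ (suc d) le)

frac-monoˡ-< : ∀ {a b} d .{{_ : NonZero d}} → a < b → frac a d <ℚ frac b d
frac-monoˡ-< {a} {b} (suc d) lt = frac-cross-< a b (suc d) (suc d) (*-monoˡ-< (suc d) lt)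

frac-if : ∀ b w d → (if b then frac w d else 0ℚ) ≡ frac (if b then w else 0) d
frac-if true  w d = refl
frac-if false w d = sym (frac-zero d)

sumℚ-map-frac : ∀ {A : Set} (f : A → ℕ) d xs → sumℚ (map (λ x → frac (f x) d) xs) ≡ frac (sum (map f xs)) d
sumℚ-map-frac f d []       = sym (frac-zero d)
sumℚ-map-frac f d (x ∷ xs) = trans (cong (frac (f x) d +ℚ_) (sumℚ-map-frac f d xs)) (frac-+ (f x) _ d)

𝟙 : Bool → ℕ
𝟙 true  = 1
𝟙 false = 0

sumCoalitions : (n : ℕ) → (Coalition n → ℕ) → ℕ
sumCoalitions zero    f = f []
sumCoalitions (suc n) f = sumCoalitions n (λ S → f (true ∷ S)) + sumCoalitions n (λ S → f (false ∷ S))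

sum-map-allCoalitions : ∀ n (f : Coalition n → ℕ) → sum (map f (allCoalitions n)) ≡ sumCoalitions n f
sum-map-allCoalitions zero    f = +-identityʳ (f [])
sum-map-allCoalitions (suc n) f = begin
  sum (map f (map (true ∷_) Cs ++ₗ map (false ∷_) Cs))
    ≡⟨ cong sum (map-++ f (map (true ∷_) Cs) (map (false ∷_) Cs)) ⟩
  sum (map f (map (true ∷_) Cs) ++ₗ map f (map (false ∷_) Cs))
    ≡⟨ sum-++ (map f (map (true ∷_) Cs)) _ ⟩
  sum (map f (map (true ∷_) Cs)) + sum (map f (map (false ∷_) Cs))
    ≡⟨ cong₂ _+_ (cong sum (sym (map-∘ Cs))) (cong sum (sym (map-∘ Cs))) ⟩
  sum (map (λ S → f (true ∷ S)) Cs) + sum (map (λ S → f (false ∷ S)) Cs)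
    ≡⟨ cong₂ _+_ (sum-map-allCoalitions n _) (sum-map-allCoalitions n _) ⟩
  sumCoalitions (suc n) f ∎
  where
  open ≡-Reasoning
  Cs = allCoalitions n

sumCoalitions-cong : ∀ n {f g : Coalition n → ℕ} → (∀ S → f S ≡ g S) → sumCoalitions n f ≡ sumCoalitions n g
sumCoalitions-cong zero    f≗g = f≗g []
sumCoalitions-cong (suc n) f≗g =
  cong₂ _+_ (sumCoalitions-cong n (λ S → f≗g (true ∷ S))) (sumCoalitions-cong n (λ S → f≗g (false ∷ S)))

sumCoalitions-zero : ∀ n → sumCoalitions n (λ _ → 0) ≡ 0
sumCoalitions-zero zero    = refl
sumCoalitions-zero (suc n) = cong₂ _+_ (sumCoalitions-zero n) (sumCoalitions-zero n)

sumCoalitions-+ : ∀ n (f g : Coalition n → ℕ) →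
  sumCoalitions n (λ S → f S + g S) ≡ sumCoalitions n f + sumCoalitions n g
sumCoalitions-+ zero    f g = refl
sumCoalitions-+ (suc n) f g = trans
  (cong₂ _+_ (sumCoalitions-+ n (λ S → f (true ∷ S)) (λ S → g (true ∷ S)))
             (sumCoalitions-+ n (λ S → f (false ∷ S)) (λ S → g (false ∷ S))))
  (+-interchange (sumCoalitions n (λ S → f (true ∷ S))) _ _ _)
  where
  +-interchange : ∀ a b c d → (a + b) + (c + d) ≡ (a + c) + (b + d)
  +-interchange = solve-∀

sumCoalitions-*ʳ : ∀ n (f : Coalition n → ℕ) c → sumCoalitions n (λ S → f S * c) ≡ sumCoalitions n f * c
sumCoalitions-*ʳ zero    f c = refl
sumCoalitions-*ʳ (suc n) f c = trans
  (cong₂ _+_ (sumCoalitions-*ʳ n (λ S → f (true ∷ S)) c) (sumCoalitions-*ʳ n (λ S → f (false ∷ S)) c))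
  (sym (*-distribʳ-+ c (sumCoalitions n (λ S → f (true ∷ S))) _))

sumCoalitions-*ˡ : ∀ n (f : Coalition n → ℕ) c → sumCoalitions n (λ S → c * f S) ≡ c * sumCoalitions n f
sumCoalitions-*ˡ n f c = begin
  sumCoalitions n (λ S → c * f S) ≡⟨ sumCoalitions-cong n (λ S → *-comm c (f S)) ⟩
  sumCoalitions n (λ S → f S * c) ≡⟨ sumCoalitions-*ʳ n f c ⟩
  sumCoalitions n f * c           ≡⟨ *-comm (sumCoalitions n f) c ⟩
  c * sumCoalitions n f           ∎
  where open ≡-Reasoning

sumCoalitions-++ : ∀ a b (f : Coalition (a + b) → ℕ) →
  sumCoalitions (a + b) f ≡ sumCoalitions a (λ xs → sumCoalitions b (λ ys → f (xs ++ ys)))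
sumCoalitions-++ zero    b f = refl
sumCoalitions-++ (suc a) b f =
  cong₂ _+_ (sumCoalitions-++ a b (λ S → f (true ∷ S))) (sumCoalitions-++ a b (λ S → f (false ∷ S)))

sumCoalitions-separable : ∀ a b (f : Coalition a → ℕ) (g : Coalition b → ℕ) →
  sumCoalitions a (λ xs → sumCoalitions b (λ ys → f xs * g ys)) ≡ sumCoalitions a f * sumCoalitions b g
sumCoalitions-separable a b f g =
  trans (sumCoalitions-cong a (λ xs → sumCoalitions-*ˡ b g (f xs))) (sumCoalitions-*ʳ a f (sumCoalitions b g))

sumCoalitions-insertAt : ∀ n (p : Fin (suc n)) (f : Coalition (suc n) → ℕ) →
  sumCoalitions (suc n) f ≡ sumCoalitions n (λ S → f (insertAt S p true) + f (insertAt S p false))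
sumCoalitions-insertAt n       zero    f = sym (sumCoalitions-+ n (λ S → f (true ∷ S)) (λ S → f (false ∷ S)))
sumCoalitions-insertAt (suc n) (suc p) f =
  cong₂ _+_ (sumCoalitions-insertAt n p (λ S → f (true ∷ S))) (sumCoalitions-insertAt n p (λ S → f (false ∷ S)))

sumCoalitions-∑ : ∀ m n (f : Fin m → Coalition n → ℕ) →
  ∑[ p < m ] sumCoalitions n (f p) ≡ sumCoalitions n (λ S → ∑[ p < m ] f p S)
sumCoalitions-∑ zero    n f = sym (sumCoalitions-zero n)
sumCoalitions-∑ (suc m) n f = trans (cong (sumCoalitions n (f zero) +_) (sumCoalitions-∑ m n (λ p → f (suc p))))
  (sym (sumCoalitions-+ n (f zero) (λ S → ∑[ p < m ] f (suc p) S)))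

sumCoalitions-card≡ : ∀ n k → sumCoalitions n (λ S → 𝟙 (card S ≡ᵇ k)) ≡ n C k
sumCoalitions-card≡ zero    zero    = refl
sumCoalitions-card≡ zero    (suc k) = refl
sumCoalitions-card≡ (suc n) zero    =
  trans (cong (_+ sumCoalitions n (λ S → 𝟙 (card S ≡ᵇ 0))) (sumCoalitions-zero n)) (sumCoalitions-card≡ n zero)
sumCoalitions-card≡ (suc n) (suc k) =
  trans (cong₂ _+_ (sumCoalitions-card≡ n k) (sumCoalitions-card≡ n (suc k))) (nCk+nC[k+1]≡[n+1]C[k+1] n k)

nCk*[k!*[n∸k]!]≡n! : ∀ {n k} → k ≤ n → (n C k) * (k ! * (n ∸ k) !) ≡ n !
nCk*[k!*[n∸k]!]≡n! {n} {k} k≤n =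
  trans (cong (_* (k ! * (n ∸ k) !)) (nCk≡n!/k![n-k]! k≤n)) (m/n*n≡m (k![n∸k]!∣n! k≤n))
  where instance _ = k !* (n ∸ k) !≢0

0<nCk : ∀ {n k} → k ≤ n → 0 < n C k
0<nCk {n} {k} k≤n with n C k | nCk*[k!*[n∸k]!]≡n! k≤n
... | zero  | 0≡n! = contradiction 0≡n! (<⇒≢ (1≤n! n))
... | suc _ | _    = s≤s z≤n

nCk*[n∸k]≡nC[1+k]*[1+k] : ∀ n k → (n C k) * (n ∸ k) ≡ (n C suc k) * suc k
nCk*[n∸k]≡nC[1+k]*[1+k] n k with k <? n
... | no  k≮n = trans (cong ((n C k) *_) (m≤n⇒m∸n≡0 (≮⇒≥ k≮n)))
  (trans (*-zeroʳ (n C k)) (cong (_* suc k) (sym (k>n⇒nCk≡0 (s≤s (≮⇒≥ k≮n))))))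
... | yes k<n = *-cancelʳ-≡ _ _ d[k+1] (begin
  (n C k) * (n ∸ k) * d[k+1]      ≡⟨ *-assoc (n C k) (n ∸ k) d[k+1] ⟩
  (n C k) * ((n ∸ k) * d[k+1])    ≡⟨ cong ((n C k) *_) ([n-k]*d[k+1]≡[k+1]*d[k] k<n) ⟩
  (n C k) * (suc k * d[k])        ≡⟨ x∙yz≈y∙xz (n C k) (suc k) d[k] ⟩
  suc k * ((n C k) * d[k])        ≡⟨ cong (suc k *_) (nCk*[k!*[n∸k]!]≡n! (<⇒≤ k<n)) ⟩
  suc k * n !                     ≡⟨ cong (suc k *_) (nCk*[k!*[n∸k]!]≡n! k<n) ⟨
  suc k * ((n C suc k) * d[k+1])  ≡⟨ x∙yz≈y∙xz (suc k) (n C suc k) d[k+1] ⟩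
  (n C suc k) * (suc k * d[k+1])  ≡⟨ *-assoc (n C suc k) (suc k) d[k+1] ⟨
  (n C suc k) * suc k * d[k+1]    ∎)
  where
  open ≡-Reasoning
  open CommSemigroupProperties *-commutativeSemigroup using (x∙yz≈y∙xz)
  d[k] = k ! * (n ∸ k) !
  d[k+1] = suc k ! * (n ∸ suc k) !
  instance _ = suc k !* (n ∸ suc k) !≢0

[xCm*yCb]*[x+y∸[m+b]] : ∀ x y m b →
  (x C m) * (y C b) * (x + y ∸ (m + b)) ≡ (x C suc m) * suc m * (y C b) + (x C m) * ((y C suc b) * suc b)
[xCm*yCb]*[x+y∸[m+b]] x y m b with m ≤? x | b ≤? y
... | yes m≤x | yes b≤y = begin
  (x C m) * (y C b) * (x + y ∸ (m + b))
    ≡⟨ cong ((x C m) * (y C b) *_) (x+y∸[m+b]≡[x∸m]+[y∸b] m≤x b≤y) ⟩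
  (x C m) * (y C b) * ((x ∸ m) + (y ∸ b))
    ≡⟨ distribute (x C m) (y C b) (x ∸ m) (y ∸ b) ⟩
  (x C m) * (x ∸ m) * (y C b) + (x C m) * ((y C b) * (y ∸ b))
    ≡⟨ cong₂ (λ u w → u * (y C b) + (x C m) * w) (nCk*[n∸k]≡nC[1+k]*[1+k] x m) (nCk*[n∸k]≡nC[1+k]*[1+k] y b) ⟩
  (x C suc m) * suc m * (y C b) + (x C m) * ((y C suc b) * suc b) ∎
  where
  open ≡-Reasoning
  distribute : ∀ A B d e → A * B * (d + e) ≡ A * d * B + A * (B * e)
  distribute = solve-∀
  x+y∸[m+b]≡[x∸m]+[y∸b] : m ≤ x → b ≤ y → x + y ∸ (m + b) ≡ (x ∸ m) + (y ∸ b)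
  x+y∸[m+b]≡[x∸m]+[y∸b] m≤x b≤y = begin
    x + y ∸ (m + b)   ≡⟨ ∸-+-assoc (x + y) m b ⟨
    x + y ∸ m ∸ b     ≡⟨ cong (_∸ b) (+-∸-comm y m≤x) ⟩
    (x ∸ m) + y ∸ b   ≡⟨ +-∸-assoc (x ∸ m) b≤y ⟩
    (x ∸ m) + (y ∸ b) ∎
... | no m≰x | _ rewrite k>n⇒nCk≡0 (≰⇒> m≰x) | k>n⇒nCk≡0 (m<n⇒m<1+n (≰⇒> m≰x)) = refl
... | yes _  | no b≰y rewrite k>n⇒nCk≡0 (≰⇒> b≰y) | k>n⇒nCk≡0 (m<n⇒m<1+n (≰⇒> b≰y)) =
  solve (x C m) (x C suc m) m (x + y ∸ (m + b))
  where
  solve : ∀ A A' m D → A * 0 * D ≡ A' * suc m * 0 + A * (0 * suc b)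
  solve = solve-∀

-- Ctail x y m r = Σ_{t ≤ r} C(x, m + t) C(y, r − t) counts the (m + r)-element subsets of a disjoint
-- union X ⊎ Y, |X| = x, |Y| = y, that meet X in at least m points.
Ctail : ℕ → ℕ → ℕ → ℕ → ℕ
Ctail x y m zero    = x C m
Ctail x y m (suc r) = (x C m) * (y C suc r) + Ctail x y (suc m) r

-- Count the pairs (T, z), z ∉ T, with T counted by Ctail x y m r, by whether T ∪ {z} has more than m
-- points in X or exactly m (and then z ∈ Y).
Ctail-step : ∀ x y m r →
  (x + y ∸ (m + r)) * Ctail x y m r ≡ suc (m + r) * Ctail x y (suc m) r + suc r * ((x C m) * (y C suc r))
Ctail-step x y m zero = begin
  (x + y ∸ (m + 0)) * (x C m)                       ≡⟨ swap (x C m) (x + y ∸ (m + 0)) ⟩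
  (x C m) * 1 * (x + y ∸ (m + 0))                   ≡⟨ [xCm*yCb]*[x+y∸[m+b]] x y m 0 ⟩
  (x C suc m) * suc m * 1 + (x C m) * ((y C 1) * 1) ≡⟨ regroup (x C suc m) (x C m) (y C 1) m ⟩
  suc (m + 0) * (x C suc m) + 1 * ((x C m) * (y C 1)) ∎
  where
  open ≡-Reasoning
  swap : ∀ A D → D * A ≡ A * 1 * D
  swap = solve-∀
  regroup : ∀ E A B m → E * suc m * 1 + A * (B * 1) ≡ suc (m + 0) * E + 1 * (A * B)
  regroup = solve-∀
Ctail-step x y m (suc r) = begin
  D * (A * B + P)
    ≡⟨ distribute A B D P ⟩
  A * B * D + D * P
    ≡⟨ cong₂ _+_ ([xCm*yCb]*[x+y∸[m+b]] x y m (suc r)) (trans (cong (_* P) D≡) (Ctail-step x y (suc m) r)) ⟩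
  (E * suc m * B + A * (B′ * suc (suc r))) + (suc (suc m + r) * P′ + suc r * (E * B))
    ≡⟨ regroup E A B B′ P′ m r ⟩
  suc (m + suc r) * (E * B + P′) + suc (suc r) * (A * B′) ∎
  where
  open ≡-Reasoning
  D = x + y ∸ (m + suc r)
  A = x C m
  B = y C suc r
  B′ = y C suc (suc r)
  E = x C suc m
  P = Ctail x y (suc m) r
  P′ = Ctail x y (suc (suc m)) r
  D≡ : D ≡ x + y ∸ (suc m + r)
  D≡ = cong (x + y ∸_) (+-suc m r)
  distribute : ∀ A B D P → D * (A * B + P) ≡ A * B * D + D * P
  distribute = solve-∀
  regroup : ∀ E A B B′ P′ m r →
    (E * suc m * B + A * (B′ * suc (suc r))) + (suc (suc m + r) * P′ + suc r * (E * B))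
    ≡ suc (m + suc r) * (E * B + P′) + suc (suc r) * (A * B′)
  regroup = solve-∀

card-++ : ∀ {a b} (xs : Coalition a) (ys : Coalition b) → card (xs ++ ys) ≡ card xs + card ys
card-++ []          ys = refl
card-++ (true ∷ xs)  ys = cong suc (card-++ xs ys)
card-++ (false ∷ xs) ys = card-++ xs ys

cardFirst-++ : ∀ {a b} (xs : Coalition a) (ys : Coalition b) → cardFirst a (xs ++ ys) ≡ card xs
cardFirst-++ []          []      = refl
cardFirst-++ []          (_ ∷ _) = refl
cardFirst-++ (true ∷ xs)  ys      = cong suc (cardFirst-++ xs ys)
cardFirst-++ (false ∷ xs) ys      = cardFirst-++ xs ys

≤ᵇ-true : ∀ {m n} → m ≤ n → (m ≤ᵇ n) ≡ true
≤ᵇ-true {m} {n} = dec-true (m ≤? n)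

≤ᵇ-false : ∀ {m n} → ¬ m ≤ n → (m ≤ᵇ n) ≡ false
≤ᵇ-false {m} {n} = dec-false (m ≤? n)

≡ᵇ-true : ∀ {m n} → m ≡ n → (m ≡ᵇ n) ≡ true
≡ᵇ-true {m} {n} = dec-true (m ≟ n)

≡ᵇ-false : ∀ {m n} → m ≢ n → (m ≡ᵇ n) ≡ false
≡ᵇ-false {m} {n} = dec-false (m ≟ n)

+-≡ᵇ-cancelˡ : ∀ m {a b} → (m + a ≡ᵇ m + b) ≡ (a ≡ᵇ b)
+-≡ᵇ-cancelˡ zero    = refl
+-≡ᵇ-cancelˡ (suc m) = +-≡ᵇ-cancelˡ m

𝟙-atLeast-base : ∀ m a b → 𝟙 (m ≤ᵇ a) * 𝟙 (a + b ≡ᵇ m + 0) ≡ 𝟙 (a ≡ᵇ m) * 𝟙 (b ≡ᵇ 0)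
𝟙-atLeast-base m a b with <-cmp a m
... | tri< a<m _ _ rewrite ≤ᵇ-false (<⇒≱ a<m) | ≡ᵇ-false (<⇒≢ a<m) = refl
... | tri≈ _ refl _ rewrite ≤ᵇ-true (≤-refl {a}) | ≡ᵇ-true (refl {x = a}) | +-≡ᵇ-cancelˡ a {b} {0} = refl
... | tri> _ _ m<a rewrite ≤ᵇ-true (<⇒≤ m<a) | ≡ᵇ-false (>⇒≢ m<a) | +-identityʳ m
                         | ≡ᵇ-false (>⇒≢ (≤-trans m<a (m≤m+n a b))) = refl

𝟙-atLeast-step : ∀ m a b r →
  𝟙 (m ≤ᵇ a) * 𝟙 (a + b ≡ᵇ m + suc r) ≡ 𝟙 (a ≡ᵇ m) * 𝟙 (b ≡ᵇ suc r) + 𝟙 (suc m ≤ᵇ a) * 𝟙 (a + b ≡ᵇ suc m + r)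
𝟙-atLeast-step m a b r with <-cmp a m
... | tri< a<m _ _ rewrite ≤ᵇ-false (<⇒≱ a<m) | ≡ᵇ-false (<⇒≢ a<m) | ≤ᵇ-false (<⇒≱ (m<n⇒m<1+n a<m)) = refl
... | tri≈ _ refl _ rewrite ≤ᵇ-true (≤-refl {a}) | ≡ᵇ-true (refl {x = a}) | +-≡ᵇ-cancelˡ a {b} {suc r}
                          | ≤ᵇ-false (n≮n a) = sym (+-identityʳ _)
... | tri> _ _ m<a rewrite ≤ᵇ-true (<⇒≤ m<a) | ≡ᵇ-false (>⇒≢ m<a) | ≤ᵇ-true m<a | +-suc m r = refl

Ctail-count : ∀ x y m r →
  sumCoalitions x (λ xs → sumCoalitions y (λ ys → 𝟙 (m ≤ᵇ card xs) * 𝟙 (card xs + card ys ≡ᵇ m + r))) ≡ Ctail x y m r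
Ctail-count x y m zero = begin
  sumCoalitions x (λ xs → sumCoalitions y (λ ys → 𝟙 (m ≤ᵇ card xs) * 𝟙 (card xs + card ys ≡ᵇ m + 0)))
    ≡⟨ sumCoalitions-cong x (λ xs → sumCoalitions-cong y (λ ys → 𝟙-atLeast-base m (card xs) (card ys))) ⟩
  sumCoalitions x (λ xs → sumCoalitions y (λ ys → 𝟙 (card xs ≡ᵇ m) * 𝟙 (card ys ≡ᵇ 0)))
    ≡⟨ sumCoalitions-separable x y (λ xs → 𝟙 (card xs ≡ᵇ m)) (λ ys → 𝟙 (card ys ≡ᵇ 0)) ⟩
  sumCoalitions x (λ xs → 𝟙 (card xs ≡ᵇ m)) * sumCoalitions y (λ ys → 𝟙 (card ys ≡ᵇ 0))
    ≡⟨ cong₂ _*_ (sumCoalitions-card≡ x m) (sumCoalitions-card≡ y 0) ⟩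
  (x C m) * 1
    ≡⟨ *-identityʳ (x C m) ⟩
  x C m ∎
  where open ≡-Reasoning
Ctail-count x y m (suc r) = begin
  sumCoalitions x (λ xs → sumCoalitions y (λ ys → 𝟙 (m ≤ᵇ card xs) * 𝟙 (card xs + card ys ≡ᵇ m + suc r)))
    ≡⟨ sumCoalitions-cong x (λ xs → trans
         (sumCoalitions-cong y (λ ys → 𝟙-atLeast-step m (card xs) (card ys) r))
         (sumCoalitions-+ y (λ ys → 𝟙 (card xs ≡ᵇ m) * 𝟙 (card ys ≡ᵇ suc r)) _)) ⟩
  sumCoalitions x (λ xs → sumCoalitions y (λ ys → 𝟙 (card xs ≡ᵇ m) * 𝟙 (card ys ≡ᵇ suc r))
                        + sumCoalitions y (λ ys → 𝟙 (suc m ≤ᵇ card xs) * 𝟙 (card xs + card ys ≡ᵇ suc m + r)))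
    ≡⟨ sumCoalitions-+ x _ _ ⟩
  sumCoalitions x (λ xs → sumCoalitions y (λ ys → 𝟙 (card xs ≡ᵇ m) * 𝟙 (card ys ≡ᵇ suc r)))
    + sumCoalitions x (λ xs → sumCoalitions y (λ ys → 𝟙 (suc m ≤ᵇ card xs) * 𝟙 (card xs + card ys ≡ᵇ suc m + r)))
    ≡⟨ cong₂ _+_ (sumCoalitions-separable x y (λ xs → 𝟙 (card xs ≡ᵇ m)) (λ ys → 𝟙 (card ys ≡ᵇ suc r)))
                 (Ctail-count x y (suc m) r) ⟩
  sumCoalitions x (λ xs → 𝟙 (card xs ≡ᵇ m)) * sumCoalitions y (λ ys → 𝟙 (card ys ≡ᵇ suc r)) + Ctail x y (suc m) r
    ≡⟨ cong (λ c → c + Ctail x y (suc m) r) (cong₂ _*_ (sumCoalitions-card≡ x m) (sumCoalitions-card≡ y (suc r))) ⟩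
  Ctail x y m (suc r) ∎
  where open ≡-Reasoning

Ctail-vandermonde : ∀ x y k → Ctail x y 0 k ≡ (x + y) C k
Ctail-vandermonde x y k = begin
  Ctail x y 0 k
    ≡⟨ Ctail-count x y 0 k ⟨
  sumCoalitions x (λ xs → sumCoalitions y (λ ys → 1 * 𝟙 (card xs + card ys ≡ᵇ k)))
    ≡⟨ sumCoalitions-cong x (λ xs → sumCoalitions-cong y (λ ys →
         trans (*-identityˡ _) (cong (λ c → 𝟙 (c ≡ᵇ k)) (sym (card-++ xs ys))))) ⟩
  sumCoalitions x (λ xs → sumCoalitions y (λ ys → 𝟙 (card (xs ++ ys) ≡ᵇ k)))
    ≡⟨ sumCoalitions-++ x y (λ S → 𝟙 (card S ≡ᵇ k)) ⟨
  sumCoalitions (x + y) (λ S → 𝟙 (card S ≡ᵇ k))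
    ≡⟨ sumCoalitions-card≡ (x + y) k ⟩
  (x + y) C k ∎
  where open ≡-Reasoning

card≤n : ∀ {n} (S : Coalition n) → card S ≤ n
card≤n []          = z≤n
card≤n (true ∷ S)  = s≤s (card≤n S)
card≤n (false ∷ S) = m≤n⇒m≤1+n (card≤n S)

card≡0⇒≡∅ : ∀ {n} (S : Coalition n) → card S ≡ 0 → S ≡ replicate n false
card≡0⇒≡∅ []          _   = refl
card≡0⇒≡∅ (false ∷ S) |S|≡0 = cong (false ∷_) (card≡0⇒≡∅ S |S|≡0)

card≡n⇒≡full : ∀ {n} (S : Coalition n) → card S ≡ n → S ≡ replicate n true
card≡n⇒≡full []          _   = refl
card≡n⇒≡full (true ∷ S)  |S|≡n = cong (true ∷_) (card≡n⇒≡full S (suc-injective |S|≡n))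
card≡n⇒≡full {suc n} (false ∷ S) |S|≡n = contradiction (subst (_≤ n) |S|≡n (card≤n S)) 1+n≰n

card-insertAt : ∀ {n} (S : Coalition n) p b → card (insertAt S p b) ≡ 𝟙 b + card S
card-insertAt S           zero    true  = refl
card-insertAt S           zero    false = refl
card-insertAt (true ∷ S)  (suc p) b     = trans (cong suc (card-insertAt S p b)) (sym (+-suc (𝟙 b) (card S)))
card-insertAt (false ∷ S) (suc p) b     = card-insertAt S p b

insertAt-[]≔ : ∀ {A : Set} {n} (xs : Vec A n) p (a b : A) → insertAt xs p a [ p ]≔ b ≡ insertAt xs p b
insertAt-[]≔ xs       zero    a b = refl
insertAt-[]≔ (x ∷ xs) (suc p) a b = cong (x ∷_) (insertAt-[]≔ xs p a b)

∑-𝟙-lookup : ∀ {n} (S : Coalition n) c → ∑[ p < n ] (𝟙 (lookup S p) * c) ≡ card S * c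
∑-𝟙-lookup []          c = refl
∑-𝟙-lookup (true ∷ S)  c = cong₂ _+_ (+-identityʳ c) (∑-𝟙-lookup S c)
∑-𝟙-lookup (false ∷ S) c = ∑-𝟙-lookup S c

∑-𝟙-not-lookup : ∀ {n} (S : Coalition n) c → ∑[ p < n ] (𝟙 (not (lookup S p)) * c) ≡ (n ∸ card S) * c
∑-𝟙-not-lookup []                  c = refl
∑-𝟙-not-lookup (true ∷ S)          c = ∑-𝟙-not-lookup S c
∑-𝟙-not-lookup {suc n} (false ∷ S) c = trans (cong₂ _+_ (+-identityʳ c) (∑-𝟙-not-lookup S c))
                                             (cong (_* c) (sym (+-∸-assoc 1 (card≤n S))))

swingWeight : ℕ → ℕ → ℕ
swingWeight n s = (s ∸ 1) ! * (n ∸ s) !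

ssNumerator : ∀ {n} → SimpleGame n → Fin n → ℕ
ssNumerator {n} v i = sumCoalitions n (λ S → if isSwing v i S then swingWeight n (card S) else 0)

shapleyShubik≡frac : ∀ {n} (v : SimpleGame n) i → shapleyShubik v i ≡ frac (ssNumerator v i) (n !)
shapleyShubik≡frac {n} v i = begin
  shapleyShubik v i
    ≡⟨ cong sumℚ (map-cong (λ S → frac-if (isSwing v i S) (swingWeight n (card S)) (n !)) (allCoalitions n)) ⟩
  sumℚ (map (λ S → frac (swing S) (n !)) (allCoalitions n))
    ≡⟨ sumℚ-map-frac swing (n !) (allCoalitions n) ⟩
  frac (sum (map swing (allCoalitions n))) (n !)
    ≡⟨ cong (λ t → frac t (n !)) (sum-map-allCoalitions n swing) ⟩
  frac (ssNumerator v i) (n !) ∎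
  where
  open ≡-Reasoning
  swing : Coalition n → ℕ
  swing S = if isSwing v i S then swingWeight n (card S) else 0

Monotone : ∀ {n} → SimpleGame n → Set
Monotone {n} v = ∀ (S : Coalition n) p → T (v (S [ p ]≔ false)) → T (v S)

-- With l = [p ∈ S], w = v S and u = v (S ∖ p), a winning coalition containing p either has p as a swing
-- or remains winning without p.
𝟙-swing-split : ∀ l w u c → (T u → T w) →
  𝟙 l * (c * 𝟙 w) ≡ (if l ∧ w ∧ not u then c else 0) + 𝟙 l * (c * 𝟙 u)
𝟙-swing-split false w     u     c _   = refl
𝟙-swing-split true  true  true  c _   = refl
𝟙-swing-split true  true  false c _   = solve c
  where
  solve : ∀ c → 1 * (c * 1) ≡ c + 1 * (c * 0)
  solve = solve-∀
𝟙-swing-split true  false true  c u⇒w = contradiction (u⇒w _) (λ ())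
𝟙-swing-split true  false false c _   = refl

sumCoalitions-remove : ∀ n (p : Fin (suc n)) (F : ℕ → Coalition (suc n) → ℕ) →
  sumCoalitions (suc n) (λ S → 𝟙 (lookup S p) * F (card S) (S [ p ]≔ false))
  ≡ sumCoalitions (suc n) (λ S → 𝟙 (not (lookup S p)) * F (suc (card S)) S)
sumCoalitions-remove n p F = begin
  sumCoalitions (suc n) member
    ≡⟨ sumCoalitions-insertAt n p member ⟩
  sumCoalitions n (λ S → member (insertAt S p true) + member (insertAt S p false))
    ≡⟨ sumCoalitions-cong n reindex ⟩
  sumCoalitions n (λ S → outsider (insertAt S p true) + outsider (insertAt S p false))
    ≡⟨ sumCoalitions-insertAt n p outsider ⟨
  sumCoalitions (suc n) outsider ∎
  where
  open ≡-Reasoning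
  member outsider : Coalition (suc n) → ℕ
  member S = 𝟙 (lookup S p) * F (card S) (S [ p ]≔ false)
  outsider S = 𝟙 (not (lookup S p)) * F (suc (card S)) S
  reindex : ∀ S → member (insertAt S p true) + member (insertAt S p false)
                ≡ outsider (insertAt S p true) + outsider (insertAt S p false)
  reindex S rewrite insertAt-lookup S p true | insertAt-lookup S p false | card-insertAt S p true
                  | card-insertAt S p false | insertAt-[]≔ S p true false =
    +-comm (1 * F (suc (card S)) (insertAt S p false)) 0

card*swingWeight : ∀ n c t → c ≤ suc n → (c ≡ 0 → t ≡ 0) → (c ≡ suc n → t ≡ 1) →
  c * (swingWeight (suc n) c * t) ≡ (suc n ∸ c) * (swingWeight (suc n) (suc c) * t) + 𝟙 (c ≡ᵇ suc n) * suc n !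
card*swingWeight n zero    t _ t≡0 _ rewrite t≡0 refl = solve (swingWeight (suc n) 1) (suc n) (suc n !)
  where
  solve : ∀ w N f → 0 ≡ N * (w * 0) + 0 * f
  solve = solve-∀
card*swingWeight n (suc c) t c<1+n _ t≡1 with m≤n⇒m<n∨m≡n (s≤s⁻¹ c<1+n)
... | inj₂ refl rewrite t≡1 refl | ≡ᵇ-true (refl {x = c}) | n∸n≡0 c = solve c (c !) (swingWeight (suc c) (suc (suc c)))
  where
  solve : ∀ c f w → suc c * (f * 1 * 1) ≡ 0 * w + 1 * (suc c * f)
  solve = solve-∀
... | inj₁ c<n rewrite ≡ᵇ-false (<⇒≢ c<n) | +-∸-assoc 1 c<n = solve c (c !) (n ∸ suc c) ((n ∸ suc c) !) t (suc n !)
  where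
  solve : ∀ c f d g t N! → suc c * (f * (suc d * g) * t) ≡ suc d * ((suc c * f) * g * t) + 0 * N!
  solve = solve-∀

-- Efficiency by double counting Y = Σ_S |S| (|S|−1)! (n−|S|)! v(S): each p ∈ S either is a swing of S or
-- leaves S ∖ p winning, so Y = Σ_p num(p) + X; and the weights telescope, so Y = X + n!.
sizeWeight : ∀ {n} → SimpleGame (suc n) → ℕ
sizeWeight {n} v = sumCoalitions (suc n) (λ S → card S * (swingWeight (suc n) (card S) * 𝟙 (v S)))

cosizeWeight : ∀ {n} → SimpleGame (suc n) → ℕ
cosizeWeight {n} v =
  sumCoalitions (suc n) (λ S → (suc n ∸ card S) * (swingWeight (suc n) (suc (card S)) * 𝟙 (v S)))

sizeWeight≡∑ssNumerator+cosizeWeight : ∀ {n} (v : SimpleGame (suc n)) → Monotone v →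
  sizeWeight v ≡ ∑[ p < suc n ] ssNumerator v p + cosizeWeight v
sizeWeight≡∑ssNumerator+cosizeWeight {n} v mono = begin
  sizeWeight v
    ≡⟨ sumCoalitions-cong N (λ S → ∑-𝟙-lookup S (K S)) ⟨
  sumCoalitions N (λ S → ∑[ p < N ] (𝟙 (lookup S p) * K S))
    ≡⟨ sumCoalitions-∑ N N (λ p S → 𝟙 (lookup S p) * K S) ⟨
  ∑[ p < N ] sumCoalitions N (λ S → 𝟙 (lookup S p) * K S)
    ≡⟨ sum-cong-≗ (λ p → sumCoalitions-cong N (λ S →
         𝟙-swing-split (lookup S p) (v S) (v (S [ p ]≔ false)) (swingWeight N (card S)) (mono S p))) ⟩
  ∑[ p < N ] sumCoalitions N (λ S → swing p S + K⁻ p S)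
    ≡⟨ sum-cong-≗ (λ p → sumCoalitions-+ N (swing p) (K⁻ p)) ⟩
  ∑[ p < N ] (ssNumerator v p + sumCoalitions N (K⁻ p))
    ≡⟨ ∑-distrib-+ (ssNumerator v) (λ p → sumCoalitions N (K⁻ p)) ⟩
  ∑[ p < N ] ssNumerator v p + ∑[ p < N ] sumCoalitions N (K⁻ p)
    ≡⟨ cong (∑[ p < N ] ssNumerator v p +_) (sum-cong-≗ (λ p →
         sumCoalitions-remove n p (λ c T → swingWeight N c * 𝟙 (v T)))) ⟩
  ∑[ p < N ] ssNumerator v p + ∑[ p < N ] sumCoalitions N (λ S → 𝟙 (not (lookup S p)) * K⁺ S)
    ≡⟨ cong (∑[ p < N ] ssNumerator v p +_) (sumCoalitions-∑ N N (λ p S → 𝟙 (not (lookup S p)) * K⁺ S)) ⟩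
  ∑[ p < N ] ssNumerator v p + sumCoalitions N (λ S → ∑[ p < N ] (𝟙 (not (lookup S p)) * K⁺ S))
    ≡⟨ cong (∑[ p < N ] ssNumerator v p +_) (sumCoalitions-cong N (λ S → ∑-𝟙-not-lookup S (K⁺ S))) ⟩
  ∑[ p < N ] ssNumerator v p + cosizeWeight v ∎
  where
  open ≡-Reasoning
  N = suc n
  K K⁺ : Coalition N → ℕ
  K S = swingWeight N (card S) * 𝟙 (v S)
  K⁺ S = swingWeight N (suc (card S)) * 𝟙 (v S)
  K⁻ : Fin N → Coalition N → ℕ
  K⁻ p S = 𝟙 (lookup S p) * (swingWeight N (card S) * 𝟙 (v (S [ p ]≔ false)))
  swing : Fin N → Coalition N → ℕ
  swing p S = if isSwing v p S then swingWeight N (card S) else 0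

sizeWeight≡cosizeWeight+n! : ∀ {n} (v : SimpleGame (suc n)) →
  v (replicate (suc n) false) ≡ false → v (replicate (suc n) true) ≡ true →
  sizeWeight v ≡ cosizeWeight v + suc n !
sizeWeight≡cosizeWeight+n! {n} v v∅ vN = begin
  sizeWeight v
    ≡⟨ sumCoalitions-cong N (λ S → card*swingWeight n (card S) (𝟙 (v S)) (card≤n S) (losing S) (winning S)) ⟩
  sumCoalitions N (λ S → (N ∸ card S) * (swingWeight N (suc (card S)) * 𝟙 (v S)) + 𝟙 (card S ≡ᵇ N) * N !)
    ≡⟨ sumCoalitions-+ N (λ S → (N ∸ card S) * (swingWeight N (suc (card S)) * 𝟙 (v S))) (λ S → 𝟙 (card S ≡ᵇ N) * N !) ⟩
  cosizeWeight v + sumCoalitions N (λ S → 𝟙 (card S ≡ᵇ N) * N !)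
    ≡⟨ cong (cosizeWeight v +_) (sumCoalitions-*ʳ N (λ S → 𝟙 (card S ≡ᵇ N)) (N !)) ⟩
  cosizeWeight v + sumCoalitions N (λ S → 𝟙 (card S ≡ᵇ N)) * N !
    ≡⟨ cong (λ c → cosizeWeight v + c * N !) (trans (sumCoalitions-card≡ N N) (nCn≡1 N)) ⟩
  cosizeWeight v + 1 * N !
    ≡⟨ cong (cosizeWeight v +_) (*-identityˡ (N !)) ⟩
  cosizeWeight v + N ! ∎
  where
  open ≡-Reasoning
  N = suc n
  losing : ∀ S → card S ≡ 0 → 𝟙 (v S) ≡ 0
  losing S |S|≡0 rewrite card≡0⇒≡∅ S |S|≡0 | v∅ = refl
  winning : ∀ S → card S ≡ N → 𝟙 (v S) ≡ 1
  winning S |S|≡N rewrite card≡n⇒≡full S |S|≡N | vN = refl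

∑-ssNumerator≡n! : ∀ {n} (v : SimpleGame (suc n)) → Monotone v →
  v (replicate (suc n) false) ≡ false → v (replicate (suc n) true) ≡ true →
  ∑[ p < suc n ] ssNumerator v p ≡ suc n !
∑-ssNumerator≡n! {n} v mono v∅ vN = +-cancelʳ-≡ (cosizeWeight v) _ _ (begin
  ∑[ p < suc n ] ssNumerator v p + cosizeWeight v ≡⟨ sizeWeight≡∑ssNumerator+cosizeWeight v mono ⟨
  sizeWeight v                                    ≡⟨ sizeWeight≡cosizeWeight+n! v v∅ vN ⟩
  cosizeWeight v + suc n !                        ≡⟨ +-comm (cosizeWeight v) (suc n !) ⟩
  suc n ! + cosizeWeight v                        ∎)
  where open ≡-Reasoning

isSwing-marginal : ∀ {n} (v : SimpleGame n) p (S⁺ S⁻ : Coalition n) (w : ℕ → ℕ) →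
  lookup S⁺ p ≡ true → lookup S⁻ p ≡ false → S⁺ [ p ]≔ false ≡ S⁻ →
  (if isSwing v p S⁺ then w (card S⁺) else 0) + (if isSwing v p S⁻ then w (card S⁻) else 0)
  ≡ (if v S⁺ ∧ not (v S⁻) then w (card S⁺) else 0)
isSwing-marginal v p S⁺ S⁻ w p∈S⁺ p∉S⁻ S⁺∖p≡S⁻ rewrite p∈S⁺ | p∉S⁻ | S⁺∖p≡S⁻ = +-identityʳ _

card-[]≔false : ∀ {n} (S : Coalition n) p → card (S [ p ]≔ false) ≤ card S
card-[]≔false (true ∷ S)  zero    = n≤1+n (card S)
card-[]≔false (false ∷ S) zero    = ≤-refl
card-[]≔false (true ∷ S)  (suc p) = s≤s (card-[]≔false S p)
card-[]≔false (false ∷ S) (suc p) = card-[]≔false S p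

cardFirst-[]≔false : ∀ {n} k (S : Coalition n) p → cardFirst k (S [ p ]≔ false) ≤ cardFirst k S
cardFirst-[]≔false zero    (_ ∷ S)     zero    = z≤n
cardFirst-[]≔false zero    (_ ∷ S)     (suc p) = z≤n
cardFirst-[]≔false (suc k) (true ∷ S)  zero    = n≤1+n (cardFirst k S)
cardFirst-[]≔false (suc k) (false ∷ S) zero    = ≤-refl
cardFirst-[]≔false (suc k) (true ∷ S)  (suc p) = s≤s (cardFirst-[]≔false k S p)
cardFirst-[]≔false (suc k) (false ∷ S) (suc p) = cardFirst-[]≔false k S p

cardFirst-replicate-false : ∀ k n → cardFirst k (replicate n false) ≡ 0
cardFirst-replicate-false k       zero    = refl
cardFirst-replicate-false zero    (suc n) = refl
cardFirst-replicate-false (suc k) (suc n) = cardFirst-replicate-false k n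

cardFirst-replicate-true : ∀ {k n} → k ≤ n → cardFirst k (replicate n true) ≡ k
cardFirst-replicate-true {zero}  {zero}  _         = refl
cardFirst-replicate-true {zero}  {suc n} _         = refl
cardFirst-replicate-true {suc k} {suc n} (s≤s k≤n) = cong suc (cardFirst-replicate-true k≤n)

card-replicate-true : ∀ n → card (replicate n true) ≡ n
card-replicate-true zero    = refl
card-replicate-true (suc n) = cong suc (card-replicate-true n)

G-monotone : ∀ x y m₁ m₂ → Monotone (G x y m₁ m₂)
G-monotone x y m₁ m₂ S p wins∖p =
  let enough₁ , enough = Equivalence.to (T-∧ {m₁ ≤ᵇ cardFirst x (S [ p ]≔ false)}) wins∖p
  in Equivalence.from T-∧ ( ≤⇒≤ᵇ (≤-trans (≤ᵇ⇒≤ m₁ _ enough₁) (cardFirst-[]≔false x S p))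
                          , ≤⇒≤ᵇ (≤-trans (≤ᵇ⇒≤ (m₁ + m₂) _ enough) (card-[]≔false S p)))

G-∅ : ∀ x y m₁ m₂ → 1 ≤ m₁ → G x y m₁ m₂ (replicate (x + y) false) ≡ false
G-∅ x y m₁ m₂ 1≤m₁ rewrite cardFirst-replicate-false x (x + y) | ≤ᵇ-false {m₁} {0} (<⇒≱ 1≤m₁) = refl

G-full : ∀ x y m₁ m₂ → m₁ ≤ x → m₂ ≤ y → G x y m₁ m₂ (replicate (x + y) true) ≡ true
G-full x y m₁ m₂ m₁≤x m₂≤y rewrite cardFirst-replicate-true (m≤m+n x y) | card-replicate-true (x + y)
  | ≤ᵇ-true m₁≤x | ≤ᵇ-true (+-mono-≤ m₁≤x m₂≤y) = refl

wins : ℕ → ℕ → ℕ → ℕ → Bool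
wins m₁ q a b = (m₁ ≤ᵇ a) ∧ (q ≤ᵇ a + b)

G-++ : ∀ {x y} m₁ m₂ (xs : Coalition x) (ys : Coalition y) →
  G x y m₁ m₂ (xs ++ ys) ≡ wins m₁ (m₁ + m₂) (card xs) (card ys)
G-++ m₁ m₂ xs ys = cong₂ (λ a c → (m₁ ≤ᵇ a) ∧ (m₁ + m₂ ≤ᵇ c)) (cardFirst-++ xs ys) (card-++ xs ys)

-- For a player of N₁ (resp. N₂), the other players are split into x players of N₁ and y of N₂.
N₁-numerator : ℕ → ℕ → ℕ → ℕ → ℕ
N₁-numerator x y m₁ m₂ = sumCoalitions x (λ xs → sumCoalitions y (λ ys →
  if wins m₁ (m₁ + m₂) (suc (card xs)) (card ys) ∧ not (wins m₁ (m₁ + m₂) (card xs) (card ys))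
  then swingWeight (suc x + y) (suc (card xs) + card ys) else 0))

N₂-marginals : ℕ → ℕ → ℕ → ℕ → ℕ
N₂-marginals x y m₁ m₂ = sumCoalitions x (λ xs → sumCoalitions y (λ ys →
  if wins m₁ (m₁ + m₂) (card xs) (suc (card ys)) ∧ not (wins m₁ (m₁ + m₂) (card xs) (card ys))
  then swingWeight (x + suc y) (card xs + suc (card ys)) else 0))

ssNumerator-G-N₁ : ∀ x y m₁ m₂ (i : Fin (suc x)) → ssNumerator (G (suc x) y m₁ m₂) (i ↑ˡ y) ≡ N₁-numerator x y m₁ m₂
ssNumerator-G-N₁ x y m₁ m₂ i = begin
  sumCoalitions (suc x + y) swing
    ≡⟨ sumCoalitions-++ (suc x) y swing ⟩
  sumCoalitions (suc x) (λ xs → sumCoalitions y (λ ys → swing (xs ++ ys)))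
    ≡⟨ sumCoalitions-insertAt x i (λ xs → sumCoalitions y (λ ys → swing (xs ++ ys))) ⟩
  sumCoalitions x (λ xs → sumCoalitions y (λ ys → swing (insertAt xs i true ++ ys))
                        + sumCoalitions y (λ ys → swing (insertAt xs i false ++ ys)))
    ≡⟨ sumCoalitions-cong x (λ xs → sumCoalitions-+ y (λ ys → swing (insertAt xs i true ++ ys))
                                                      (λ ys → swing (insertAt xs i false ++ ys))) ⟨
  sumCoalitions x (λ xs → sumCoalitions y (λ ys → swing (insertAt xs i true ++ ys) + swing (insertAt xs i false ++ ys)))
    ≡⟨ sumCoalitions-cong x (λ xs → sumCoalitions-cong y (λ ys → marginal xs ys)) ⟩
  N₁-numerator x y m₁ m₂ ∎
  where
  open ≡-Reasoning
  v = G (suc x) y m₁ m₂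
  p = i ↑ˡ y
  W = swingWeight (suc x + y)
  swing : Coalition (suc x + y) → ℕ
  swing S = if isSwing v p S then W (card S) else 0
  marginal : ∀ xs ys → swing (insertAt xs i true ++ ys) + swing (insertAt xs i false ++ ys)
    ≡ (if wins m₁ (m₁ + m₂) (suc (card xs)) (card ys) ∧ not (wins m₁ (m₁ + m₂) (card xs) (card ys))
       then W (suc (card xs) + card ys) else 0)
  marginal xs ys = trans
    (isSwing-marginal v p (insertAt xs i true ++ ys) (insertAt xs i false ++ ys) W
      (trans (lookup-++ˡ (insertAt xs i true) ys i) (insertAt-lookup xs i true))
      (trans (lookup-++ˡ (insertAt xs i false) ys i) (insertAt-lookup xs i false))
      (trans ([]≔-++-↑ˡ (insertAt xs i true) ys i) (cong (_++ ys) (insertAt-[]≔ xs i true false))))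
    (cong₂ (λ won c → if won then W c else 0)
      (cong₂ (λ w⁺ w⁻ → w⁺ ∧ not w⁻)
        (trans (G-++ m₁ m₂ (insertAt xs i true) ys)
               (cong (λ a → wins m₁ (m₁ + m₂) a (card ys)) (card-insertAt xs i true)))
        (trans (G-++ m₁ m₂ (insertAt xs i false) ys)
               (cong (λ a → wins m₁ (m₁ + m₂) a (card ys)) (card-insertAt xs i false))))
      (trans (card-++ (insertAt xs i true) ys) (cong (_+ card ys) (card-insertAt xs i true))))

ssNumerator-G-N₂ : ∀ x y m₁ m₂ (j : Fin (suc y)) → ssNumerator (G x (suc y) m₁ m₂) (x ↑ʳ j) ≡ N₂-marginals x y m₁ m₂
ssNumerator-G-N₂ x y m₁ m₂ j = begin
  sumCoalitions (x + suc y) swing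
    ≡⟨ sumCoalitions-++ x (suc y) swing ⟩
  sumCoalitions x (λ xs → sumCoalitions (suc y) (λ ys → swing (xs ++ ys)))
    ≡⟨ sumCoalitions-cong x (λ xs → sumCoalitions-insertAt y j (λ ys → swing (xs ++ ys))) ⟩
  sumCoalitions x (λ xs → sumCoalitions y (λ ys → swing (xs ++ insertAt ys j true) + swing (xs ++ insertAt ys j false)))
    ≡⟨ sumCoalitions-cong x (λ xs → sumCoalitions-cong y (λ ys → marginal xs ys)) ⟩
  N₂-marginals x y m₁ m₂ ∎
  where
  open ≡-Reasoning
  v = G x (suc y) m₁ m₂
  p = x ↑ʳ j
  W = swingWeight (x + suc y)
  swing : Coalition (x + suc y) → ℕ
  swing S = if isSwing v p S then W (card S) else 0
  marginal : ∀ xs ys → swing (xs ++ insertAt ys j true) + swing (xs ++ insertAt ys j false)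
    ≡ (if wins m₁ (m₁ + m₂) (card xs) (suc (card ys)) ∧ not (wins m₁ (m₁ + m₂) (card xs) (card ys))
       then W (card xs + suc (card ys)) else 0)
  marginal xs ys = trans
    (isSwing-marginal v p (xs ++ insertAt ys j true) (xs ++ insertAt ys j false) W
      (trans (lookup-++ʳ xs (insertAt ys j true) j) (insertAt-lookup ys j true))
      (trans (lookup-++ʳ xs (insertAt ys j false) j) (insertAt-lookup ys j false))
      (trans ([]≔-++-↑ʳ xs (insertAt ys j true) j) (cong (xs ++_) (insertAt-[]≔ ys j true false))))
    (cong₂ (λ won c → if won then W c else 0)
      (cong₂ (λ w⁺ w⁻ → w⁺ ∧ not w⁻)
        (trans (G-++ m₁ m₂ xs (insertAt ys j true))
               (cong (wins m₁ (m₁ + m₂) (card xs)) (card-insertAt ys j true)))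
        (trans (G-++ m₁ m₂ xs (insertAt ys j false))
               (cong (wins m₁ (m₁ + m₂) (card xs)) (card-insertAt ys j false))))
      (trans (card-++ xs (insertAt ys j true)) (cong (card xs +_) (card-insertAt ys j true))))

wins-true : ∀ {m q a b} → m ≤ a → q ≤ a + b → wins m q a b ≡ true
wins-true m≤a q≤a+b rewrite ≤ᵇ-true m≤a | ≤ᵇ-true q≤a+b = refl

wins-false : ∀ {m q a b} → ¬ q ≤ a + b → wins m q a b ≡ false
wins-false {m} {q} {a} {b} q≰a+b rewrite ≤ᵇ-false q≰a+b with m ≤ᵇ a
... | true  = refl
... | false = refl

+-suc-cong : ∀ a b c d → a + b ≡ c + d → a + suc b ≡ c + suc d
+-suc-cong a b c d eq = trans (+-suc a b) (trans (cong suc eq) (sym (+-suc c d)))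

+-suc-mono-< : ∀ a b c d → a + b < c + d → a + suc b < c + suc d
+-suc-mono-< a b c d lt = subst₂ _<_ (sym (+-suc a b)) (sym (+-suc c d)) (s≤s lt)

N₂-marginal-zero : ∀ m a b w → (if wins m (m + 0) a (suc b) ∧ not (wins m (m + 0) a b) then w else 0) ≡ 0
N₂-marginal-zero m a b w with m ≤? a
... | no m≰a rewrite ≤ᵇ-false m≰a = refl
... | yes m≤a
  rewrite wins-true {m} {m + 0} {a} {suc b} m≤a (≤-trans (≤-reflexive (+-identityʳ m)) (≤-trans m≤a (m≤m+n a (suc b))))
        | wins-true {m} {m + 0} {a} {b} m≤a (≤-trans (≤-reflexive (+-identityʳ m)) (≤-trans m≤a (m≤m+n a b))) = refl

N₂-marginal-suc : ∀ m r a b n →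
  (if wins m (m + suc r) a (suc b) ∧ not (wins m (m + suc r) a b) then swingWeight n (a + suc b) else 0)
  ≡ 𝟙 (m ≤ᵇ a) * 𝟙 (a + b ≡ᵇ m + r) * swingWeight n (m + suc r)
N₂-marginal-suc m r a b n with m ≤? a
... | no m≰a rewrite ≤ᵇ-false m≰a = refl
... | yes m≤a with <-cmp (a + b) (m + r)
...   | tri< a+b<m+r _ _
  rewrite wins-false {m} {m + suc r} {a} {suc b} (<⇒≱ (+-suc-mono-< a b m r a+b<m+r))
        | ≡ᵇ-false (<⇒≢ a+b<m+r) | ≤ᵇ-true m≤a = refl
...   | tri≈ _ a+b≡m+r _
  rewrite wins-true {m} {m + suc r} {a} {suc b} m≤a (≤-reflexive (sym (+-suc-cong a b m r a+b≡m+r)))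
        | wins-false {m} {m + suc r} {a} {b} (<⇒≱ (subst (a + b <_) (sym (+-suc m r)) (s≤s (≤-reflexive a+b≡m+r))))
        | ≡ᵇ-true a+b≡m+r | ≤ᵇ-true m≤a =
  trans (cong (swingWeight n) (+-suc-cong a b m r a+b≡m+r)) (sym (*-identityˡ (swingWeight n (m + suc r))))
...   | tri> _ _ m+r<a+b
  rewrite wins-true {m} {m + suc r} {a} {suc b} m≤a (<⇒≤ (+-suc-mono-< m r a b m+r<a+b))
        | wins-true {m} {m + suc r} {a} {b} m≤a (subst (_≤ a + b) (sym (+-suc m r)) m+r<a+b)
        | ≡ᵇ-false (>⇒≢ m+r<a+b) | ≤ᵇ-true m≤a = refl

-- The swings of a player of N₂ are the coalitions containing it of size exactly m₁ + m₂ (> m₁)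
-- with at least m₁ players of N₁; here |N₁| = x and |N₂| = 1 + y.
N₂-numerator : ℕ → ℕ → ℕ → ℕ → ℕ
N₂-numerator x y m₁ zero    = 0
N₂-numerator x y m₁ (suc r) = swingWeight (x + suc y) (m₁ + suc r) * Ctail x y m₁ r

N₂-marginals≡N₂-numerator : ∀ x y m₁ m₂ → N₂-marginals x y m₁ m₂ ≡ N₂-numerator x y m₁ m₂
N₂-marginals≡N₂-numerator x y m₁ zero = trans
  (sumCoalitions-cong x (λ xs → trans (sumCoalitions-cong y (λ ys → N₂-marginal-zero m₁ (card xs) (card ys) _))
                                      (sumCoalitions-zero y)))
  (sumCoalitions-zero x)
N₂-marginals≡N₂-numerator x y m₁ (suc r) = begin
  N₂-marginals x y m₁ (suc r)
    ≡⟨ sumCoalitions-cong x (λ xs → sumCoalitions-cong y (λ ys →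
         N₂-marginal-suc m₁ r (card xs) (card ys) (x + suc y))) ⟩
  sumCoalitions x (λ xs → sumCoalitions y (λ ys → count xs ys * W))
    ≡⟨ sumCoalitions-cong x (λ xs → sumCoalitions-*ʳ y (count xs) W) ⟩
  sumCoalitions x (λ xs → sumCoalitions y (count xs) * W)
    ≡⟨ sumCoalitions-*ʳ x (λ xs → sumCoalitions y (count xs)) W ⟩
  sumCoalitions x (λ xs → sumCoalitions y (count xs)) * W
    ≡⟨ cong (_* W) (Ctail-count x y m₁ r) ⟩
  Ctail x y m₁ r * W
    ≡⟨ *-comm (Ctail x y m₁ r) W ⟩
  N₂-numerator x y m₁ (suc r) ∎
  where
  open ≡-Reasoning
  W = swingWeight (x + suc y) (m₁ + suc r)
  count : Coalition x → Coalition y → ℕ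
  count xs ys = 𝟙 (m₁ ≤ᵇ card xs) * 𝟙 (card xs + card ys ≡ᵇ m₁ + r)

ladder : ∀ {A : Set} {_≺_ : A → A → Set} → Transitive _≺_ → (f : ℕ → A) →
  ∀ {a b} → a < b → (∀ k → a ≤ k → k < b → f k ≺ f (suc k)) → f a ≺ f b
ladder {_≺_ = _≺_} ≺-trans f {a} {suc b} (s≤s a≤b) step with m≤n⇒m<n∨m≡n a≤b
... | inj₂ refl = step a ≤-refl ≤-refl
... | inj₁ a<b  = ≺-trans (ladder {_≺_ = _≺_} ≺-trans f a<b (λ k a≤k k<b → step k a≤k (m<n⇒m<1+n k<b)))
                          (step b (<⇒≤ a<b) ≤-refl)

0<*0< : ∀ {a b} → 0 < a → 0 < b → 0 < a * b
0<*0< {suc a} {suc b} _ _ = s≤s z≤n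

commonFactor : ℕ → ℕ → ℕ → ℕ → ℕ
commonFactor x y m r = (m + r) ! * (x + y ∸ suc (m + r)) !

0<commonFactor : ∀ x y m r → 0 < commonFactor x y m r
0<commonFactor x y m r = 0<*0< (1≤n! (m + r)) (1≤n! (x + y ∸ suc (m + r)))

N₂-numerator-suc : ∀ x y m r → m + r < x + y →
  N₂-numerator x y m (suc r)
  ≡ commonFactor x y m r * (suc (m + r) * Ctail x y (suc m) r + suc r * ((x C m) * (y C suc r)))
N₂-numerator-suc x y m r m+r<x+y = begin
  (m + suc r ∸ 1) ! * (x + suc y ∸ (m + suc r)) ! * Ctail x y m r
    ≡⟨ cong₂ (λ u w → u ! * w ! * Ctail x y m r) (cong (_∸ 1) (+-suc m r)) x+1+y∸[m+1+r]≡1+[x+y∸[1+m+r]] ⟩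
  (m + r) ! * (suc (x + y ∸ suc (m + r))) ! * Ctail x y m r
    ≡⟨ regroup ((m + r) !) (x + y ∸ suc (m + r)) ((x + y ∸ suc (m + r)) !) (Ctail x y m r) ⟩
  commonFactor x y m r * (suc (x + y ∸ suc (m + r)) * Ctail x y m r)
    ≡⟨ cong (λ d → commonFactor x y m r * (d * Ctail x y m r)) (+-∸-assoc 1 m+r<x+y) ⟨
  commonFactor x y m r * ((x + y ∸ (m + r)) * Ctail x y m r)
    ≡⟨ cong (commonFactor x y m r *_) (Ctail-step x y m r) ⟩
  commonFactor x y m r * (suc (m + r) * Ctail x y (suc m) r + suc r * ((x C m) * (y C suc r))) ∎
  where
  open ≡-Reasoning
  x+1+y∸[m+1+r]≡1+[x+y∸[1+m+r]] : x + suc y ∸ (m + suc r) ≡ suc (x + y ∸ suc (m + r))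
  x+1+y∸[m+1+r]≡1+[x+y∸[1+m+r]] =
    trans (cong₂ _∸_ (+-suc x y) (+-suc m r)) (+-∸-assoc 1 m+r<x+y)
  regroup : ∀ a d e p → a * (suc d * e) * p ≡ a * e * (suc d * p)
  regroup = solve-∀

N₂-numerator-suc-suc : ∀ x y m r →
  N₂-numerator x y m (suc (suc r)) ≡ commonFactor x y m r * (suc (m + r) * Ctail x y m (suc r))
N₂-numerator-suc-suc x y m r = begin
  (m + suc (suc r) ∸ 1) ! * (x + suc y ∸ (m + suc (suc r))) ! * Ctail x y m (suc r)
    ≡⟨ cong₂ (λ u w → u ! * w ! * Ctail x y m (suc r))
         (cong (_∸ 1) (trans (+-suc m (suc r)) (cong suc (+-suc m r))))
         (trans (cong₂ _∸_ (+-suc x y) (trans (+-suc m (suc r)) (cong suc (+-suc m r)))) refl) ⟩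
  (suc (m + r)) ! * (x + y ∸ suc (m + r)) ! * Ctail x y m (suc r)
    ≡⟨ regroup (m + r) ((m + r) !) ((x + y ∸ suc (m + r)) !) (Ctail x y m (suc r)) ⟩
  commonFactor x y m r * (suc (m + r) * Ctail x y m (suc r)) ∎
  where
  open ≡-Reasoning
  regroup : ∀ k a d p → (suc k * a) * d * p ≡ a * d * (suc k * p)
  regroup = solve-∀

N₂-numerator-suc-m : ∀ x y m r →
  N₂-numerator x y (suc m) (suc r) ≡ commonFactor x y m r * (suc (m + r) * Ctail x y (suc m) r)
N₂-numerator-suc-m x y m r = begin
  (suc m + suc r ∸ 1) ! * (x + suc y ∸ (suc m + suc r)) ! * Ctail x y (suc m) r
    ≡⟨ cong₂ (λ u w → u ! * w ! * Ctail x y (suc m) r) (+-suc m r) (cong₂ _∸_ (+-suc x y) (cong suc (+-suc m r))) ⟩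
  (suc (m + r)) ! * (x + y ∸ suc (m + r)) ! * Ctail x y (suc m) r
    ≡⟨ regroup (m + r) ((m + r) !) ((x + y ∸ suc (m + r)) !) (Ctail x y (suc m) r) ⟩
  commonFactor x y m r * (suc (m + r) * Ctail x y (suc m) r) ∎
  where
  open ≡-Reasoning
  regroup : ∀ k a d p → (suc k * a) * d * p ≡ a * d * (suc k * p)
  regroup = solve-∀

0<N₂-numerator : ∀ x y m → m ≤ x → 0 < N₂-numerator x y m 1
0<N₂-numerator x y m m≤x = 0<*0< (0<*0< (1≤n! (m + 1 ∸ 1)) (1≤n! (x + suc y ∸ (m + 1)))) (0<nCk m≤x)

N₂-numerator-step-m₂ : ∀ x y m r → 1 ≤ m → m ≤ x → suc (suc r) ≤ y →
  N₂-numerator x y m (suc r) < N₂-numerator x y m (suc (suc r))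
N₂-numerator-step-m₂ x y m r 1≤m m≤x 2+r≤y
  rewrite N₂-numerator-suc x y m r (+-mono-≤-< m≤x (≤-trans (n≤1+n (suc r)) 2+r≤y))
        | N₂-numerator-suc-suc x y m r =
  *-monoʳ-< (commonFactor x y m r) {{>-nonZero (0<commonFactor x y m r)}} (begin-strict
    suc (m + r) * P + suc r * AB
      <⟨ +-monoʳ-< (suc (m + r) * P) (*-monoˡ-< AB {{>-nonZero 0<AB}} (s≤s (+-monoˡ-≤ r 1≤m))) ⟩
    suc (m + r) * P + suc (m + r) * AB
      ≡⟨ regroup (suc (m + r)) P AB ⟩
    suc (m + r) * (AB + P) ∎)
  where
  open ≤-Reasoning
  P = Ctail x y (suc m) r
  AB = (x C m) * (y C suc r)
  0<AB : 0 < AB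
  0<AB = 0<*0< (0<nCk m≤x) (0<nCk (≤-trans (n≤1+n (suc r)) 2+r≤y))
  regroup : ∀ k p q → k * p + k * q ≡ k * (q + p)
  regroup = solve-∀

N₂-numerator-step-m₁ : ∀ x y m r → suc m ≤ x → suc r ≤ y →
  N₂-numerator x y (suc m) (suc r) < N₂-numerator x y m (suc r)
N₂-numerator-step-m₁ x y m r m<x r<y
  rewrite N₂-numerator-suc x y m r (+-mono-< m<x r<y) | N₂-numerator-suc-m x y m r =
  *-monoʳ-< (commonFactor x y m r) {{>-nonZero (0<commonFactor x y m r)}}
    (m<m+n (suc (m + r) * Ctail x y (suc m) r)
      (0<*0< {suc r} (s≤s z≤n) (0<*0< {x C m} {y C suc r} (0<nCk (<⇒≤ m<x)) (0<nCk r<y))))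

N₂-numerator-strictMono-m₂ : ∀ x y m {q q′} → 1 ≤ m → m ≤ x → q < q′ → q′ ≤ y →
  N₂-numerator x y m q < N₂-numerator x y m q′
N₂-numerator-strictMono-m₂ x y m {q} {q′} 1≤m m≤x q<q′ q′≤y = ladder {_≺_ = _<_} <-trans (N₂-numerator x y m) q<q′ step
  where
  step : ∀ k → q ≤ k → k < q′ → N₂-numerator x y m k < N₂-numerator x y m (suc k)
  step zero    _ _    = 0<N₂-numerator x y m m≤x
  step (suc r) _ k<q′ = N₂-numerator-step-m₂ x y m r 1≤m m≤x (≤-trans k<q′ q′≤y)

N₂-numerator-strictAnti-m₁ : ∀ x y r {m m′} → m′ < m → m ≤ x → suc r ≤ y →
  N₂-numerator x y m (suc r) < N₂-numerator x y m′ (suc r)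
N₂-numerator-strictAnti-m₁ x y r {m} {m′} m′<m m≤x 1+r≤y =
  ladder {_≺_ = _>_} (λ a>b b>c → <-trans b>c a>b) (λ k → N₂-numerator x y k (suc r)) m′<m step
  where
  step : ∀ k → m′ ≤ k → k < m → N₂-numerator x y (suc k) (suc r) < N₂-numerator x y k (suc r)
  step k _ k<m = N₂-numerator-step-m₁ x y k r (≤-trans k<m m≤x) 1+r≤y

N₂-numerator-anti-m₁ : ∀ x y {m₁ m₁′} q → m₁′ ≤ m₁ → m₁ ≤ x → q ≤ y →
  N₂-numerator x y m₁ q ≤ N₂-numerator x y m₁′ q
N₂-numerator-anti-m₁ x y zero    _     _    _   = z≤n
N₂-numerator-anti-m₁ x y (suc r) m₁′≤m₁ m₁≤x q≤y with m≤n⇒m<n∨m≡n m₁′≤m₁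
... | inj₂ refl  = ≤-refl
... | inj₁ m₁′<m₁ = <⇒≤ (N₂-numerator-strictAnti-m₁ x y r m₁′<m₁ m₁≤x q≤y)

N₂-numerator-mono : ∀ x y {m₁ m₂ m₁′ m₂′} → 1 ≤ m₁′ → m₁′ ≤ m₁ → m₁ ≤ x → m₂ ≤ m₂′ → m₂′ ≤ y →
  N₂-numerator x y m₁ m₂ ≤ N₂-numerator x y m₁′ m₂′
N₂-numerator-mono x y {m₂ = m₂} 1≤m₁′ m₁′≤m₁ m₁≤x m₂≤m₂′ m₂′≤y with m≤n⇒m<n∨m≡n m₂≤m₂′
... | inj₂ refl  = N₂-numerator-anti-m₁ x y m₂ m₁′≤m₁ m₁≤x m₂′≤y
... | inj₁ m₂<m₂′ = ≤-trans (N₂-numerator-anti-m₁ x y m₂ m₁′≤m₁ m₁≤x (≤-trans m₂≤m₂′ m₂′≤y))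
  (<⇒≤ (N₂-numerator-strictMono-m₂ x y _ 1≤m₁′ (≤-trans m₁′≤m₁ m₁≤x) m₂<m₂′ m₂′≤y))

N₂-numerator-strict : ∀ x y {m₁ m₂ m₁′ m₂′} → 1 ≤ m₁′ → m₁′ ≤ m₁ → m₁ ≤ x → m₂ ≤ m₂′ → m₂′ ≤ y →
  ¬ (m₁ ≡ m₁′ × m₂ ≡ m₂′) → ¬ (m₂ ≡ 0 × m₂′ ≡ 0) → N₂-numerator x y m₁ m₂ < N₂-numerator x y m₁′ m₂′
N₂-numerator-strict x y {m₂ = m₂} 1≤m₁′ m₁′≤m₁ m₁≤x m₂≤m₂′ m₂′≤y ≢ m₂≢0 with m≤n⇒m<n∨m≡n m₂≤m₂′
... | inj₁ m₂<m₂′ = ≤-<-trans (N₂-numerator-anti-m₁ x y m₂ m₁′≤m₁ m₁≤x (≤-trans m₂≤m₂′ m₂′≤y))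
  (N₂-numerator-strictMono-m₂ x y _ 1≤m₁′ (≤-trans m₁′≤m₁ m₁≤x) m₂<m₂′ m₂′≤y)
... | inj₂ refl with m≤n⇒m<n∨m≡n m₁′≤m₁ | m₂
...   | inj₂ refl   | _     = contradiction (refl , refl) ≢
...   | inj₁ _      | zero  = contradiction (refl , refl) m₂≢0
...   | inj₁ m₁′<m₁ | suc r = N₂-numerator-strictAnti-m₁ x y r m₁′<m₁ m₁≤x m₂′≤y

N₂-numerator-1-top : ∀ x r → N₂-numerator x (suc r) 1 (suc r) < (x + suc r) !
N₂-numerator-1-top x r = begin-strict
  N₂-numerator x y 1 y     ≡⟨ cong (λ d → y ! * d ! * P) (m+n∸n≡m x (suc y)) ⟩
  y ! * x ! * P            ≡⟨ cong (_* P) (*-comm (y !) (x !)) ⟩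
  x ! * y ! * P            <⟨ *-monoʳ-< (x ! * y !) {{>-nonZero (0<*0< (1≤n! x) (1≤n! y))}} ≤-refl ⟩
  x ! * y ! * suc P        ≡⟨ cong (x ! * y ! *_) 1+P≡[x+y]Cy ⟩
  x ! * y ! * ((x + y) C y) ≡⟨ *-comm (x ! * y !) _ ⟩
  ((x + y) C y) * (x ! * y !) ≡⟨ cong (λ d → ((x + y) C y) * (d ! * y !)) (m+n∸n≡m x y) ⟨
  ((x + y) C y) * ((x + y ∸ y) ! * y !) ≡⟨ cong (((x + y) C y) *_) (*-comm ((x + y ∸ y) !) (y !)) ⟩
  ((x + y) C y) * (y ! * (x + y ∸ y) !) ≡⟨ nCk*[k!*[n∸k]!]≡n! (m≤n+m y x) ⟩
  (x + y) ! ∎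
  where
  open ≤-Reasoning
  y = suc r
  P = Ctail x y 1 r
  1+P≡[x+y]Cy : suc P ≡ (x + y) C y
  1+P≡[x+y]Cy = begin-equality
    suc P              ≡⟨ cong (λ c → c + P) (nCn≡1 y) ⟨
    (y C y) + P        ≡⟨ cong (_+ P) (*-identityˡ (y C y)) ⟨
    Ctail x y 0 y      ≡⟨ Ctail-vandermonde x y y ⟩
    (x + y) C y        ∎

balance-≤ : ∀ {a b t₁ t₂ t₁′ t₂′} → .{{NonZero a}} → a * t₁ + b * t₂ ≡ a * t₁′ + b * t₂′ → t₂ ≤ t₂′ → t₁′ ≤ t₁
balance-≤ {a} {b} {t₁} {t₂} {t₁′} eq t₂≤t₂′ = *-cancelˡ-≤ a (+-cancelʳ-≤ (b * t₂) (a * t₁′) (a * t₁)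
  (≤-trans (+-monoʳ-≤ (a * t₁′) (*-monoʳ-≤ b t₂≤t₂′)) (≤-reflexive (sym eq))))

balance-< : ∀ {a b t₁ t₂ t₁′ t₂′} → .{{NonZero a}} → .{{NonZero b}} →
  a * t₁ + b * t₂ ≡ a * t₁′ + b * t₂′ → t₂ < t₂′ → t₁′ < t₁
balance-< {a} {b} {t₁} {t₂} {t₁′} eq t₂<t₂′ = *-cancelˡ-< a t₁′ t₁ (+-cancelʳ-< (b * t₂) (a * t₁′) (a * t₁)
  (<-≤-trans (+-monoʳ-< (a * t₁′) (*-monoʳ-< b t₂<t₂′)) (≤-reflexive (sym eq))))

balance-≡ : ∀ {a b t₁ t₁′ t₂} → .{{NonZero a}} → a * t₁ + b * t₂ ≡ a * t₁′ + b * t₂ → t₁ ≡ t₁′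
balance-≡ {a} {b} {t₁} {t₁′} {t₂} eq =
  ≤-antisym (balance-≤ {a} {b} {t₁′} {t₂} {t₁} {t₂} (sym eq) ≤-refl) (balance-≤ {a} {b} {t₁} {t₂} {t₁′} {t₂} eq ≤-refl)

balance-average : ∀ {a b t₁ t₂ D} → .{{NonZero b}} → a * t₁ + b * t₂ ≡ D → t₂ * (a + b) < D → D < t₁ * (a + b)
balance-average {a} {b} {t₁} {t₂} {D} eq t₂[a+b]<D = begin-strict
  D                  ≡⟨ eq ⟨
  a * t₁ + b * t₂    <⟨ +-monoʳ-< (a * t₁) (*-monoʳ-< b t₂<t₁) ⟩
  a * t₁ + b * t₁    ≡⟨ regroup a b t₁ ⟩
  t₁ * (a + b)       ∎
  where
  open ≤-Reasoning
  regroup : ∀ a b t → a * t + b * t ≡ t * (a + b)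
  regroup = solve-∀
  t₂<t₁ : t₂ < t₁
  t₂<t₁ = *-cancelˡ-< a t₂ t₁ (+-cancelʳ-< (b * t₂) (a * t₂) (a * t₁)
    (<-≤-trans (subst (_< D) (sym (regroup a b t₂)) t₂[a+b]<D) (≤-reflexive (sym eq))))

∑-↑ˡ-↑ʳ : ∀ a b (f : Fin (a + b) → ℕ) → ∑[ p < a + b ] f p ≡ ∑[ i < a ] f (i ↑ˡ b) + ∑[ j < b ] f (a ↑ʳ j)
∑-↑ˡ-↑ʳ zero    b f = refl
∑-↑ˡ-↑ʳ (suc a) b f = trans (cong (f zero +_) (∑-↑ˡ-↑ʳ a b (λ p → f (suc p)))) (sym (+-assoc (f zero) _ _))

∑-const : ∀ n (f : Fin n → ℕ) {c} → (∀ i → f i ≡ c) → ∑[ i < n ] f i ≡ n * c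
∑-const zero    f f≡c = refl
∑-const (suc n) f f≡c = cong₂ _+_ (f≡c zero) (∑-const n (λ i → f (suc i)) (λ i → f≡c (suc i)))

G-efficient : ∀ x y m₁ m₂ → 1 ≤ m₁ → m₁ ≤ suc x → m₂ ≤ y →
  suc x * N₁-numerator x (suc y) m₁ m₂ + suc y * N₂-numerator (suc x) y m₁ m₂ ≡ (suc x + suc y) !
G-efficient x y m₁ m₂ 1≤m₁ m₁≤1+x m₂≤y = begin
  suc x * N₁-numerator x (suc y) m₁ m₂ + suc y * N₂-numerator (suc x) y m₁ m₂
    ≡⟨ cong₂ _+_ (∑-const (suc x) (λ i → ssNumerator v (i ↑ˡ suc y)) (ssNumerator-G-N₁ x (suc y) m₁ m₂))
                 (∑-const (suc y) (λ j → ssNumerator v (suc x ↑ʳ j))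
                   (λ j → trans (ssNumerator-G-N₂ (suc x) y m₁ m₂ j) (N₂-marginals≡N₂-numerator (suc x) y m₁ m₂))) ⟨
  ∑[ i < suc x ] ssNumerator v (i ↑ˡ suc y) + ∑[ j < suc y ] ssNumerator v (suc x ↑ʳ j)
    ≡⟨ ∑-↑ˡ-↑ʳ (suc x) (suc y) (ssNumerator v) ⟨
  ∑[ p < suc x + suc y ] ssNumerator v p
    ≡⟨ ∑-ssNumerator≡n! v (G-monotone (suc x) (suc y) m₁ m₂) (G-∅ (suc x) (suc y) m₁ m₂ 1≤m₁)
                          (G-full (suc x) (suc y) m₁ m₂ m₁≤1+x (m≤n⇒m≤1+n m₂≤y)) ⟩
  (suc x + suc y) ! ∎
  where
  open ≡-Reasoning
  v = G (suc x) (suc y) m₁ m₂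

SS₁≡frac : ∀ x y m₁ m₂ (i : Fin (suc x)) →
  SS₁ (suc x) (suc y) m₁ m₂ i ≡ frac (N₁-numerator x (suc y) m₁ m₂) ((suc x + suc y) !)
SS₁≡frac x y m₁ m₂ i = trans (shapleyShubik≡frac (G (suc x) (suc y) m₁ m₂) (i ↑ˡ suc y))
  (cong (λ t → frac t ((suc x + suc y) !)) (ssNumerator-G-N₁ x (suc y) m₁ m₂ i))

SS₂≡frac : ∀ x y m₁ m₂ (j : Fin (suc y)) →
  SS₂ (suc x) (suc y) m₁ m₂ j ≡ frac (N₂-numerator (suc x) y m₁ m₂) ((suc x + suc y) !)
SS₂≡frac x y m₁ m₂ j = trans (shapleyShubik≡frac (G (suc x) (suc y) m₁ m₂) (suc x ↑ʳ j))
  (cong (λ t → frac t ((suc x + suc y) !))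
    (trans (ssNumerator-G-N₂ (suc x) y m₁ m₂ j) (N₂-marginals≡N₂-numerator (suc x) y m₁ m₂)))

-- The two parts of the theorem, for n₁ = 1 + x and n₂ = 1 + y

SS-comparison : ∀ x y (i : Fin (suc x)) (j : Fin (suc y)) (m₁ m₂ m₁′ m₂′ : ℕ) →
  Admissible (suc x) (suc y) m₁ m₂ → Admissible (suc x) (suc y) m₁′ m₂′ →
  ¬ (m₁ ≡ m₁′ × m₂ ≡ m₂′) → m₁′ ≤ m₁ → m₂ ≤ m₂′ →
  (SS₂ (suc x) (suc y) m₁ m₂ j ≤ℚ SS₂ (suc x) (suc y) m₁′ m₂′ j)
  × (SS₁ (suc x) (suc y) m₁′ m₂′ i ≤ℚ SS₁ (suc x) (suc y) m₁ m₂ i)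
  × ((SS₂ (suc x) (suc y) m₁ m₂ j ≡ SS₂ (suc x) (suc y) m₁′ m₂′ j) ⇔ (m₂ ≡ 0 × m₂′ ≡ 0))
  × ((SS₁ (suc x) (suc y) m₁ m₂ i ≡ SS₁ (suc x) (suc y) m₁′ m₂′ i) ⇔ (m₂ ≡ 0 × m₂′ ≡ 0))
SS-comparison x y i j m₁ m₂ m₁′ m₂′ (1≤m₁ , m₁≤n₁ , s≤s m₂≤y) (1≤m₁′ , m₁′≤n₁ , s≤s m₂′≤y) distinct m₁′≤m₁ m₂≤m₂′
  rewrite SS₁≡frac x y m₁ m₂ i | SS₁≡frac x y m₁′ m₂′ i | SS₂≡frac x y m₁ m₂ j | SS₂≡frac x y m₁′ m₂′ j =
    frac-monoˡ-≤ D t₂≤t₂′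
  , frac-monoˡ-≤ D (balance-≤ {suc x} {suc y} same-total t₂≤t₂′)
  , mk⇔ (zeros-if-equal (frac-monoˡ-< D))
        (λ (m₂≡0 , m₂′≡0) → cong (λ t → frac t D) (t₂≡t₂′ m₂≡0 m₂′≡0))
  , mk⇔ (λ eq → zeros-if-equal (λ t₂<t₂′ → frac-monoˡ-< D (balance-< {suc x} {suc y} same-total t₂<t₂′)) (sym eq))
        (λ (m₂≡0 , m₂′≡0) → cong (λ t → frac t D)
          (balance-≡ {suc x} {suc y}
            (trans same-total (cong (λ t → suc x * t₁′ + suc y * t) (sym (t₂≡t₂′ m₂≡0 m₂′≡0))))))
  where
  D = (suc x + suc y) !
  instance _ = (suc x + suc y) !≢0
  t₁ = N₁-numerator x (suc y) m₁ m₂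
  t₁′ = N₁-numerator x (suc y) m₁′ m₂′
  t₂ = N₂-numerator (suc x) y m₁ m₂
  t₂′ = N₂-numerator (suc x) y m₁′ m₂′
  same-total : suc x * t₁ + suc y * t₂ ≡ suc x * t₁′ + suc y * t₂′
  same-total = trans (G-efficient x y m₁ m₂ 1≤m₁ m₁≤n₁ m₂≤y) (sym (G-efficient x y m₁′ m₂′ 1≤m₁′ m₁′≤n₁ m₂′≤y))
  t₂≤t₂′ : t₂ ≤ t₂′
  t₂≤t₂′ = N₂-numerator-mono (suc x) y 1≤m₁′ m₁′≤m₁ m₁≤n₁ m₂≤m₂′ m₂′≤y
  t₂≡t₂′ : m₂ ≡ 0 → m₂′ ≡ 0 → t₂ ≡ t₂′
  t₂≡t₂′ m₂≡0 m₂′≡0 = trans (cong (N₂-numerator (suc x) y m₁) m₂≡0) (sym (cong (N₂-numerator (suc x) y m₁′) m₂′≡0))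
  zeros-if-equal : ∀ {p q} → (t₂ < t₂′ → p <ℚ q) → p ≡ q → m₂ ≡ 0 × m₂′ ≡ 0
  zeros-if-equal strict p≡q with (m₂ ≟ 0) ×-dec (m₂′ ≟ 0)
  ... | yes zeros    = zeros
  ... | no not-zeros = contradiction p≡q (ℚ.<⇒≢ (strict
          (N₂-numerator-strict (suc x) y 1≤m₁′ m₁′≤m₁ m₁≤n₁ m₂≤m₂′ m₂′≤y distinct not-zeros)))

SS-bounds : ∀ x y (i : Fin (suc x)) (j : Fin (suc y)) → 2 ≤ suc y → (m₁ m₂ c : ℕ) →
  1 ≤ m₂ → m₂ ≤ y → 1 ≤ m₁ → m₁ ≤ suc x → 1 ≤ c → c ≤ suc x →
    (frac 1 (suc x + suc y) <ℚ SS₁ (suc x) (suc y) 1 y i)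
  × (SS₁ (suc x) (suc y) 1 y i ≤ℚ SS₁ (suc x) (suc y) m₁ m₂ i)
  × (SS₁ (suc x) (suc y) m₁ m₂ i ≤ℚ SS₁ (suc x) (suc y) (suc x) 1 i)
  × (SS₁ (suc x) (suc y) (suc x) 1 i <ℚ SS₁ (suc x) (suc y) c 0 i)
  × (SS₁ (suc x) (suc y) c 0 i ≡ frac 1 (suc x))
  × (SS₂ (suc x) (suc y) 1 y j <ℚ frac 1 (suc x + suc y))
  × (SS₂ (suc x) (suc y) m₁ m₂ j ≤ℚ SS₂ (suc x) (suc y) 1 y j)
  × (SS₂ (suc x) (suc y) (suc x) 1 j ≤ℚ SS₂ (suc x) (suc y) m₁ m₂ j)
  × (SS₂ (suc x) (suc y) c 0 j <ℚ SS₂ (suc x) (suc y) (suc x) 1 j)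
  × (SS₂ (suc x) (suc y) c 0 j ≡ 0ℚ)
SS-bounds x y@(suc r) i j (s≤s (s≤s z≤n)) m₁ m₂ c 1≤m₂ m₂≤y 1≤m₁ m₁≤n₁ 1≤c c≤n₁
  rewrite SS₁≡frac x y 1 y i | SS₁≡frac x y m₁ m₂ i | SS₁≡frac x y (suc x) 1 i | SS₁≡frac x y c 0 i
        | SS₂≡frac x y 1 y j | SS₂≡frac x y m₁ m₂ j | SS₂≡frac x y (suc x) 1 j | SS₂≡frac x y c 0 j =
    frac-cross-< 1 (t₁ 1 y) n D
      (subst (_< t₁ 1 y * n) (sym (*-identityˡ D)) (balance-average {suc x} {suc y} {t₁ 1 y} {t₂ 1 y} total-top t₂-top))
  , frac-monoˡ-≤ D (balance-≤ {suc x} {suc y} (trans total-m (sym total-top)) t₂m≤t₂-top)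
  , frac-monoˡ-≤ D (balance-≤ {suc x} {suc y} (trans total-n₁ (sym total-m)) t₂n≤t₂m)
  , frac-monoˡ-< D (balance-< {suc x} {suc y} (trans total-c (sym total-n₁)) 0<t₂n)
  , frac-cross-≡ (t₁ c 0) 1 D (suc x) t₁c*n₁≡D
  , frac-cross-< (t₂ 1 y) 1 D n (subst (t₂ 1 y * n <_) (sym (*-identityˡ D)) t₂-top)
  , frac-monoˡ-≤ D t₂m≤t₂-top
  , frac-monoˡ-≤ D t₂n≤t₂m
  , frac-monoˡ-< D 0<t₂n
  , frac-zero D
  where
  n = suc x + suc y
  D = n !
  instance _ = n !≢0
  t₁ t₂ : ℕ → ℕ → ℕ
  t₁ = N₁-numerator x (suc y)
  t₂ = N₂-numerator (suc x) y
  total-top : suc x * t₁ 1 y + suc y * t₂ 1 y ≡ D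
  total-top = G-efficient x y 1 y ≤-refl (s≤s z≤n) ≤-refl
  total-m : suc x * t₁ m₁ m₂ + suc y * t₂ m₁ m₂ ≡ D
  total-m = G-efficient x y m₁ m₂ 1≤m₁ m₁≤n₁ m₂≤y
  total-n₁ : suc x * t₁ (suc x) 1 + suc y * t₂ (suc x) 1 ≡ D
  total-n₁ = G-efficient x y (suc x) 1 (s≤s z≤n) ≤-refl (s≤s z≤n)
  total-c : suc x * t₁ c 0 + suc y * t₂ c 0 ≡ D
  total-c = G-efficient x y c 0 1≤c c≤n₁ z≤n
  t₂-top : t₂ 1 y * n < D
  t₂-top = begin-strict
    t₂ 1 y * n             ≡⟨ *-comm (t₂ 1 y) n ⟩
    n * t₂ 1 y             <⟨ *-monoʳ-< n (N₂-numerator-1-top (suc x) r) ⟩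
    n * (suc x + suc r) !  ≡⟨ cong (λ k → n * k !) (+-suc x (suc r)) ⟨
    D                      ∎
    where open ≤-Reasoning
  t₂m≤t₂-top : t₂ m₁ m₂ ≤ t₂ 1 y
  t₂m≤t₂-top = N₂-numerator-mono (suc x) y ≤-refl 1≤m₁ m₁≤n₁ m₂≤y ≤-refl
  t₂n≤t₂m : t₂ (suc x) 1 ≤ t₂ m₁ m₂
  t₂n≤t₂m = N₂-numerator-mono (suc x) y 1≤m₁ m₁≤n₁ ≤-refl 1≤m₂ m₂≤y
  0<t₂n : 0 < t₂ (suc x) 1
  0<t₂n = 0<N₂-numerator (suc x) y (suc x) ≤-refl
  t₁c*n₁≡D : t₁ c 0 * suc x ≡ 1 * D
  t₁c*n₁≡D = begin
    t₁ c 0 * suc x                  ≡⟨ *-comm (t₁ c 0) (suc x) ⟩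
    suc x * t₁ c 0                  ≡⟨ +-identityʳ (suc x * t₁ c 0) ⟨
    suc x * t₁ c 0 + 0              ≡⟨ cong (suc x * t₁ c 0 +_) (*-zeroʳ (suc y)) ⟨
    suc x * t₁ c 0 + suc y * t₂ c 0 ≡⟨ total-c ⟩
    D                               ≡⟨ *-identityˡ D ⟨
    1 * D                           ∎
    where open ≡-Reasoning

corollary4p2 : (n₁ n₂ : ℕ) → 1 ≤ n₁ → 1 ≤ n₂ → (i : Fin n₁) → (j : Fin n₂) →
    ((m₁ m₂ m₁' m₂' : ℕ) → Admissible n₁ n₂ m₁ m₂ → Admissible n₁ n₂ m₁' m₂' →
      ¬ (m₁ ≡ m₁' × m₂ ≡ m₂') → m₁' ≤ m₁ → m₂ ≤ m₂' →
      (SS₂ n₁ n₂ m₁ m₂ j ≤ℚ SS₂ n₁ n₂ m₁' m₂' j)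
      × (SS₁ n₁ n₂ m₁' m₂' i ≤ℚ SS₁ n₁ n₂ m₁ m₂ i)
      × ((SS₂ n₁ n₂ m₁ m₂ j ≡ SS₂ n₁ n₂ m₁' m₂' j) ⇔ (m₂ ≡ 0 × m₂' ≡ 0))
      × ((SS₁ n₁ n₂ m₁ m₂ i ≡ SS₁ n₁ n₂ m₁' m₂' i) ⇔ (m₂ ≡ 0 × m₂' ≡ 0)))
    ×
    (2 ≤ n₂ → (m₁ m₂ c : ℕ) → 1 ≤ m₂ → m₂ ≤ n₂ ∸ 1 → 1 ≤ m₁ → m₁ ≤ n₁ → 1 ≤ c → c ≤ n₁ →
      (frac 1 (n₁ + n₂) <ℚ SS₁ n₁ n₂ 1 (n₂ ∸ 1) i)
      × (SS₁ n₁ n₂ 1 (n₂ ∸ 1) i ≤ℚ SS₁ n₁ n₂ m₁ m₂ i)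
      × (SS₁ n₁ n₂ m₁ m₂ i ≤ℚ SS₁ n₁ n₂ n₁ 1 i)
      × (SS₁ n₁ n₂ n₁ 1 i <ℚ SS₁ n₁ n₂ c 0 i)
      × (SS₁ n₁ n₂ c 0 i ≡ frac 1 n₁)
      × (SS₂ n₁ n₂ 1 (n₂ ∸ 1) j <ℚ frac 1 (n₁ + n₂))
      × (SS₂ n₁ n₂ m₁ m₂ j ≤ℚ SS₂ n₁ n₂ 1 (n₂ ∸ 1) j)
      × (SS₂ n₁ n₂ n₁ 1 j ≤ℚ SS₂ n₁ n₂ m₁ m₂ j)
      × (SS₂ n₁ n₂ c 0 j <ℚ SS₂ n₁ n₂ n₁ 1 j)
      × (SS₂ n₁ n₂ c 0 j ≡ 0ℚ))
corollary4p2 (suc x) (suc y) _ _ i j = SS-comparison x y i j , SS-bounds x y i j
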